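{- Let $\mathcal{K}$ be any subclass of $\mathrm{Ob}(\mathbf{FA})$ containing $\{(\mathcal{C}_T,P_T): T \text{ is an } \mathcal{L}^m\text{ -theory}\}$. Then $\models_{\mathcal{K}}$ is a sound and complete semantics for $\mathcal{L}^m$: for every signature $Sg$ and all $Sg$-theories $T,T'$, $T\vdash_{\mathcal{L}^m}T'$ if and only if $T\models_{\mathcal{K}}T'$.
   Context: Syntax. A first-order language $\mathscr{L}$ consists of a class $\mathscr{L}_q$ of quantifier symbols and a class $\mathscr{L}_\omega$ of propositional connectives, each with an arity ($\mathscr{L}_n$ = arity $n$), containing designated $e\in\mathscr{L}_0$, $\otimes\in\mathscr{L}_2$. A signature $Sg$ has sort symbols, function symbols $f:\sigma_1,\dots,\sigma_n\to\tau$ and relation symbols $R\subseteq\sigma_1,\dots,\sigma_n$. Contexts $\Gamma=x_1:\sigma_1,\dots,x_n:\sigma_n$; terms-in-context $M:\tau\ [\Gamma]$ built from variables of $\Gamma$ and function symbols; formulas-in-context $\phi\ [\Gamma]$ built from $R(M_1,..,M_n)$, $M_1=_\sigma M_2$, connectives $\Diamond\in\mathscr{L}_n$, and $\Omega_{x:\sigma}(\phi)\ [\Gamma]$ from $\phi\ [\Gamma,x:\sigma]$ ($\Omega\in\mathscr{L}_q$), up to $\alpha$-equivalence with capture-avoiding substitution. Assertions: equations-in-context $M_1=M_2:\tau\ [\Gamma]$ and sequents-in-context $\phi_1,..,\phi_n\vdash\phi_{n+1}\ [\Gamma]$ ($n\ge0$). An $Sg$-theory is a set $A(T)$ of $Sg$-assertions.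 A logic $\mathcal{L}$ assigns to each signature a closure operator $T\mapsto T_{\mathcal{L}}$ on $Sg$-theories (ordered by inclusion) whose closed theories satisfy typed equational logic (reflexivity, symmetry, transitivity, and: from $M=M':\sigma\ [\Delta]$, $N=N':\tau\ [\Gamma,x:\sigma,\Gamma']$ infer $N[M/x]=N'[M'/x]:\tau\ [\Gamma,\Gamma']$ when the variable–sort pairs of $\Delta$ occur in $\Gamma,\Gamma'$); $T\vdash_{\mathcal{L}}T'$ means $A(T')\subseteq A(T_{\mathcal{L}})$; $T$ is an $\mathcal{L}$-theory if $T=T_{\mathcal{L}}$. $\mathcal{L}^m$ is the least logic closed under: (Ax) $\phi\vdash\phi\ [\Gamma]$; (Cut) $\phi\vdash\psi$, $\psi\vdash\theta$ $\Rightarrow$ $\phi\vdash\theta$ in $[\Gamma]$; (Cwk) $\Phi\vdash\psi\ [\Gamma]\Rightarrow\Phi\vdash\psi\ [\Gamma,x:\sigma]$; (Sub) from $M=M':\sigma\ [\Delta]$ and $\Phi\vdash\psi\ [\Gamma,x:\sigma,\Gamma']$ infer $\Phi[M/x]\vdash\psi[M'/x]\ [\Gamma,\Gamma']$ (variables of $\Delta$ among those of $\Gamma,\Gamma'$); ($\Omega$-Con) from $\phi\vdash\psi$ and $\psi\vdash\phi$ in $[\Gamma,x:\sigma]$ infer $\Omega_{x:\sigma}\phi\vdash\Omega_{x:\sigma}\psi\ [\Gamma]$; ($\Diamond$-Cong) from $\phi_i\vdash\phi_i'$, $\phi_i'\vdash\phi_i$ in $[\Gamma]$ infer $\Diamond(\vec\phi)\vdash\Diamond(\vec\phi')\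 [\Gamma]$; ($\otimes$-Ref) $\Phi,\alpha,\beta,\Psi\vdash\theta\ [\Gamma]$ iff $\Phi,\alpha\otimes\beta,\Psi\vdash\theta\ [\Gamma]$; ($e$-Ref) $\Phi,e,\Psi\vdash\phi\ [\Gamma]$ iff $\Phi,\Psi\vdash\phi\ [\Gamma]$. $\mathbf{FA}$. A prop-category $(\mathcal{C},P)$: a category with designated finite products ($1$, $c\times d$, $\pi_1,\pi_2$) and a contravariant functor $P:\mathcal{C}\to\mathbf{Pos}$. $\mathrm{Ob}(\mathbf{FA})$: prop-categories with (1) $\mathscr{L}_\omega$-algebra structures on each $P(c)$ with each $P(f)$ a homomorphism; (2) $Eq_c\in P(c\times c)$; (3) natural transformations $\Omega_{(-),c}:UP(-\times c)\Rightarrow UP$ for $\Omega\in\mathscr{L}_q$ ($U$ forgetful), components $\Omega_{b,c}:P(b\times c)\to P(b)$; (4) $(P(c),\otimes,e_c)$ a monoid; (5) $\Omega_{b,1}\circ P(\pi_1^{b,1})=\mathrm{id}$ and $\Omega_{b,c\times d}\circ P(a_{b,c,d})=\Omega_{b,c}\circ\Omega_{b\times c,d}$ with $a_{b,c,d}:b\times(c\times d)\to(b\times c)\times d$ canonical; (6) $Eq_1=e_{1\times1}$ and for $c=c_1\times c_2$, $Eq_c=P(\langle\pi_1^{c_1,c_2}\pi_1^{c,c},\pi_1^{c_1,c_2}\pi_2^{c,c}\rangle)(Eq_{c_1})\otimes P(\langle\pi_2^{c_1,c_2}\pi_1^{c,c},\pi_2^{c_1,c_2}\pi_2^{c,c}\rangle)(Eq_{c_2})$.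 Structures and satisfaction. An $Sg$-structure $S$ in $(\mathcal{C},P)\in\mathrm{Ob}(\mathbf{FA})$ assigns objects $[\![\sigma]\!]$ to sorts, morphisms $[\![f]\!]:[\![\sigma_1]\!]\times\dots\times[\![\sigma_n]\!]\to[\![\tau]\!]$, and elements $[\![R]\!]\in P([\![\sigma_1]\!]\times\dots\times[\![\sigma_n]\!])$; $[\![\Gamma]\!]$ is the product of the sorts of $\Gamma$ (empty product $1$). Terms: variables as projections, $[\![f(\vec M)]\!]=[\![f]\!]\circ\langle[\![M_i]\!]\rangle$. Formulas: $[\![R(\vec M)[\Gamma]]\!]=P(\langle[\![M_i[\Gamma]]\!]\rangle)([\![R]\!])$; $[\![M_1=_\tau M_2[\Gamma]]\!]=P(\langle[\![M_1]\!],[\![M_2]\!]\rangle)(Eq_{[\![\tau]\!]})$; $[\![\Diamond(\vec\phi)[\Gamma]]\!]=\Diamond^{P([\![\Gamma]\!])}([\![\phi_i[\Gamma]]\!])$; $[\![\Omega_{x:\sigma}\phi[\Gamma]]\!]=\Omega_{[\![\Gamma]\!],[\![\sigma]\!]}(P(a)([\![\phi[\Gamma,x:\sigma]]\!]))$ with $a:[\![\Gamma]\!]\times[\![\sigma]\!]\to[\![\Gamma,x:\sigma]\!]$ canonical. $S$ satisfies $M_1=M_2:\tau\ [\Gamma]$ if $[\![M_1[\Gamma]]\!]=[\![M_2[\Gamma]]\!]$, and $\phi_1,..,\phi_n\vdash\phi\ [\Gamma]$ if $[\![\phi_1]\!]\otimes\dots\otimes[\![\phi_n]\!]\le[\![\phi]\!]$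 in $P([\![\Gamma]\!])$ ($e_{[\![\Gamma]\!]}$ if $n=0$). $S$ is a $T$-model if it satisfies all of $A(T)$. For $\mathcal{X}\subseteq\mathrm{Ob}(\mathbf{FA})$, $T\models_{\mathcal{X}}T'$ iff every $T$-model in a member of $\mathcal{X}$ is a $T'$-model. Classifying prop-category $(\mathcal{C}_T,P_T)$ of an $Sg$-theory $T$: objects are contexts (up to renaming); morphisms $\Gamma'\to\Gamma=x_1:\sigma_1..x_n:\sigma_n$ are lists of terms $N_i:\sigma_i\ [\Gamma']$ modulo provable-in-$T$ equality, composed by substitution; products by concatenation; $P_T(\Gamma)$ = formulas in $[\Gamma]$ modulo mutual derivability in $T$, ordered by $\phi\vdash\psi\ [\Gamma]\in A(T)$; $P_T$ on morphisms by simultaneous substitution; connectives act on representatives ($e_\Gamma=[e]$); $\Omega_{\Gamma,\Gamma'}[\phi]=[\Omega_{y_1:\tau_1}\cdots\Omega_{y_m:\tau_m}\phi]$ for $\Gamma'=y_1:\tau_1..y_m:\tau_m$; $Eq_\Gamma=[x_1=_{\sigma_1}x_1'\otimes\dots\otimes x_n=_{\sigma_n}x_n']$ ($Eq_{[\,]}=[e]$). -}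

module Defs where

open import Level using (Level)
open import Data.Nat using (ℕ)
open import Data.Fin using (Fin)
open import Data.Unit using (⊤)
open import Data.Sum using (_⊎_; inj₁; inj₂)
open import Data.Product using (Σ; _,_; proj₁) renaming (_×_ to _∧_)
open import Data.Vec as Vec using (Vec; []; _∷_)
open import Data.Vec.Relation.Binary.Pointwise.Inductive using (Pointwise)
open import Data.List as List using (List; []; _∷_; _++_; [_])
open import Data.List.Properties using (++-identityʳ; ++-assoc)
open import Data.List.Relation.Unary.Any using (here; there)
open import Data.List.Relation.Unary.All as All using (All; []; _∷_)
open import Data.List.Membership.Propositional using (_∈_)
open import Data.List.Membership.Propositional.Properties using (∈-++⁺ˡ; ∈-++⁺ʳ; ∈-++⁻)
open import Relation.Binary.PropositionalEquality using (_≡_; refl; sym; subst)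
open import Relation.Binary.Structures using (IsEquivalence; IsPartialOrder)

record Language : Set₁ where
  field
    QSym  : Set
    Conn  : ℕ → Set
    eC    : Conn 0
    ⊗C    : Conn 2

record Signature : Set₁ where
  field
    Sort : Set
    Fun  : List Sort → Sort → Set
    Rel  : List Sort → Set

-- Syntax (contexts as lists of sorts, variables as de Bruijn positions;
-- this identifies α-equivalent terms/formulas)

module Syntax (L : Language) (Sg : Signature) where
  open Language L
  open Signature Sg

  Ctx : Set
  Ctx = List Sort

  mutual
    data Tm (Γ : Ctx) : Sort → Set where
      var : ∀ {σ} → σ ∈ Γ → Tm Γ σ
      app : ∀ {σs τ} → Fun σs τ → Tms Γ σs → Tm Γ τ

    data Tms (Γ : Ctx) : List Sort → Set where
      []  : Tms Γ []
      _∷_ : ∀ {σ σs} → Tm Γ σ → Tms Γ σs → Tms Γ (σ ∷ σs)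

  _▹_ : Ctx → Sort → Ctx
  Γ ▹ σ = Γ ++ [ σ ]

  data Fm : Ctx → Set where
    rel : ∀ {Γ σs} → Rel σs → Tms Γ σs → Fm Γ
    eq  : ∀ {Γ} (σ : Sort) → Tm Γ σ → Tm Γ σ → Fm Γ
    con : ∀ {Γ n} → Conn n → Vec (Fm Γ) n → Fm Γ
    qnt : ∀ {Γ} → QSym → (σ : Sort) → Fm (Γ ▹ σ) → Fm Γ

  eF : ∀ {Γ} → Fm Γ
  eF = con eC []

  _⊗F_ : ∀ {Γ} → Fm Γ → Fm Γ → Fm Γ
  φ ⊗F ψ = con ⊗C (φ ∷ ψ ∷ [])

  Subst : Ctx → Ctx → Set
  Subst Δ Γ = All (Tm Δ) Γ

  Ren : Ctx → Ctx → Set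
  Ren Δ Γ = ∀ {σ} → σ ∈ Δ → σ ∈ Γ

  ren : ∀ {Δ Γ} → Ren Γ Δ → Subst Δ Γ
  ren ρ = All.tabulate (λ i → var (ρ i))

  _++ᴬ_ : ∀ {Δ Γ Γ'} → Subst Δ Γ → Subst Δ Γ' → Subst Δ (Γ ++ Γ')
  [] ++ᴬ t = t
  (M ∷ s) ++ᴬ t = M ∷ (s ++ᴬ t)

  mutual
    substTm : ∀ {Δ Γ σ} → Subst Δ Γ → Tm Γ σ → Tm Δ σ
    substTm s (var i) = All.lookup s i
    substTm s (app f Ms) = app f (substTms s Ms)

    substTms : ∀ {Δ Γ σs} → Subst Δ Γ → Tms Γ σs → Tms Δ σs
    substTms s [] = []
    substTms s (M ∷ Ms) = substTm s M ∷ substTms s Ms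

  lift : ∀ {Δ Γ} → Subst Δ Γ → (σ : Sort) → Subst (Δ ▹ σ) (Γ ▹ σ)
  lift {Δ} s σ = All.map (substTm (ren ∈-++⁺ˡ)) s ++ᴬ (var (∈-++⁺ʳ Δ (here refl)) ∷ [])

  mutual
    substFm : ∀ {Δ Γ} → Subst Δ Γ → Fm Γ → Fm Δ
    substFm s (rel R Ms) = rel R (substTms s Ms)
    substFm s (eq σ M N) = eq σ (substTm s M) (substTm s N)
    substFm s (con o φs) = con o (substFms s φs)
    substFm s (qnt Ω σ φ) = qnt Ω σ (substFm (lift s σ) φ)

    substFms : ∀ {Δ Γ n} → Subst Δ Γ → Vec (Fm Γ) n → Vec (Fm Δ) n
    substFms s [] = []
    substFms s (φ ∷ φs) = substFm s φ ∷ substFms s φs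

  wkFm : ∀ {Γ σ} → Fm Γ → Fm (Γ ▹ σ)
  wkFm = substFm (ren ∈-++⁺ˡ)

  sub1 : (Γ : Ctx) {Γ' : Ctx} {σ : Sort} → Tm (Γ ++ Γ') σ → Subst (Γ ++ Γ') (Γ ++ σ ∷ Γ')
  sub1 Γ {Γ'} {σ} N = All.tabulate f
    where
    f : ∀ {τ} → τ ∈ Γ ++ σ ∷ Γ' → Tm (Γ ++ Γ') τ
    f i with ∈-++⁻ Γ i
    ... | inj₁ j = var (∈-++⁺ˡ j)
    ... | inj₂ (here refl) = N
    ... | inj₂ (there j) = var (∈-++⁺ʳ Γ j)

  -- injective renamings: "the variable–sort pairs of Δ occur in Γ"
  InjRen : Ctx → Ctx → Set
  InjRen Δ Γ = Σ (Ren Δ Γ) λ ρ → ∀ {σ} (i j : σ ∈ Δ) → ρ i ≡ ρ j → i ≡ j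

  data Assertion : Set where
    eqn : (Γ : Ctx) (τ : Sort) → Tm Γ τ → Tm Γ τ → Assertion
    seq : (Γ : Ctx) → List (Fm Γ) → Fm Γ → Assertion

  Theory : Set₁
  Theory = Assertion → Set

  data Der (T : Theory) : Assertion → Set where
    hyp     : ∀ {a} → T a → Der T a
    e-refl  : ∀ {Γ τ} (M : Tm Γ τ) → Der T (eqn Γ τ M M)
    e-sym   : ∀ {Γ τ M N} → Der T (eqn Γ τ M N) → Der T (eqn Γ τ N M)
    e-trans : ∀ {Γ τ M N P} → Der T (eqn Γ τ M N) → Der T (eqn Γ τ N P) → Der T (eqn Γ τ M P)
    e-sub   : ∀ {Δ σ τ M M'} (Γ Γ' : Ctx) {N N'} (ρ : InjRen Δ (Γ ++ Γ')) →
              Der T (eqn Δ σ M M') → Der T (eqn (Γ ++ σ ∷ Γ') τ N N') →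
              Der T (eqn (Γ ++ Γ') τ (substTm (sub1 Γ (substTm (ren (proj₁ ρ)) M)) N)
                                     (substTm (sub1 Γ (substTm (ren (proj₁ ρ)) M')) N'))
    ax      : ∀ {Γ} (φ : Fm Γ) → Der T (seq Γ (φ ∷ []) φ)
    cut     : ∀ {Γ φ ψ θ} → Der T (seq Γ (φ ∷ []) ψ) → Der T (seq Γ (ψ ∷ []) θ) →
              Der T (seq Γ (φ ∷ []) θ)
    cwk     : ∀ {Γ Φ ψ} (σ : Sort) → Der T (seq Γ Φ ψ) →
              Der T (seq (Γ ▹ σ) (List.map wkFm Φ) (wkFm ψ))
    sub     : ∀ {Δ σ M M'} (Γ Γ' : Ctx) {Φ ψ} (ρ : InjRen Δ (Γ ++ Γ')) →
              Der T (eqn Δ σ M M') → Der T (seq (Γ ++ σ ∷ Γ') Φ ψ) →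
              Der T (seq (Γ ++ Γ')
                         (List.map (substFm (sub1 Γ (substTm (ren (proj₁ ρ)) M))) Φ)
                         (substFm (sub1 Γ (substTm (ren (proj₁ ρ)) M')) ψ))
    Ω-con   : ∀ {Γ σ φ ψ} (Ω : QSym) → Der T (seq (Γ ▹ σ) (φ ∷ []) ψ) →
              Der T (seq (Γ ▹ σ) (ψ ∷ []) φ) →
              Der T (seq Γ (qnt Ω σ φ ∷ []) (qnt Ω σ ψ))
    ◇-cong  : ∀ {Γ n} (o : Conn n) (φs ψs : Vec (Fm Γ) n) →
              (∀ (i : Fin n) → Der T (seq Γ (Vec.lookup φs i ∷ []) (Vec.lookup ψs i))) →
              (∀ (i : Fin n) → Der T (seq Γ (Vec.lookup ψs i ∷ []) (Vec.lookup φs i))) →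
              Der T (seq Γ (con o φs ∷ []) (con o ψs))
    ⊗-ref⇒  : ∀ {Γ} Φ α β Ψ θ → Der T (seq Γ (Φ ++ α ∷ β ∷ Ψ) θ) →
              Der T (seq Γ (Φ ++ (α ⊗F β) ∷ Ψ) θ)
    ⊗-ref⇐  : ∀ {Γ} Φ α β Ψ θ → Der T (seq Γ (Φ ++ (α ⊗F β) ∷ Ψ) θ) →
              Der T (seq Γ (Φ ++ α ∷ β ∷ Ψ) θ)
    e-ref⇒  : ∀ {Γ} Φ Ψ φ → Der T (seq Γ (Φ ++ eF ∷ Ψ) φ) → Der T (seq Γ (Φ ++ Ψ) φ)
    e-ref⇐  : ∀ {Γ} Φ Ψ φ → Der T (seq Γ (Φ ++ Ψ) φ) → Der T (seq Γ (Φ ++ eF ∷ Ψ) φ)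

  _⊢ₘ_ : Theory → Theory → Set
  T ⊢ₘ T' = ∀ a → T' a → Der T a

  IsLmTheory : Theory → Set
  IsLmTheory T = ∀ a → Der T a → T a

-- The class Ob(FA): raw data and laws (setoid presentation; all
-- equalities of morphisms / of elements of P(c) are the given ones)

module FA (L : Language) where
  open Language L

  record FAData : Set₁ where
    infixr 9 _∘_
    infixr 7 _×_
    field
      Obj   : Set
      Hom   : Obj → Obj → Set
      _≈_   : ∀ {a b} → Hom a b → Hom a b → Set
      id    : ∀ {a} → Hom a a
      _∘_   : ∀ {a b c} → Hom b c → Hom a b → Hom a c
      𝟙     : Obj
      !     : ∀ {a} → Hom a 𝟙
      _×_   : Obj → Obj → Obj
      π₁    : ∀ {a b} → Hom (a × b) a
      π₂    : ∀ {a b} → Hom (a × b) b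
      ⟨_,_⟩ : ∀ {a b c} → Hom c a → Hom c b → Hom c (a × b)
      PC    : Obj → Set
      _≈P_  : ∀ {c} → PC c → PC c → Set
      _≤P_  : ∀ {c} → PC c → PC c → Set
      Pmap  : ∀ {a b} → Hom a b → PC b → PC a
      conn  : ∀ {c n} → Conn n → Vec (PC c) n → PC c
      Eq    : ∀ c → PC (c × c)
      quant : QSym → ∀ b c → PC (b × c) → PC b

    e : ∀ c → PC c
    e c = conn eC []

    _⊗_ : ∀ {c} → PC c → PC c → PC c
    x ⊗ y = conn ⊗C (x ∷ y ∷ [])

  record FALaws (D : FAData) : Set where
    open FAData D
    field
      ≈-equiv  : ∀ {a b} → IsEquivalence (_≈_ {a} {b})
      ∘-resp   : ∀ {a b c} {f f' : Hom b c} {g g' : Hom a b} → f ≈ f' → g ≈ g' → (f ∘ g) ≈ (f' ∘ g')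
      idˡ      : ∀ {a b} (f : Hom a b) → (id ∘ f) ≈ f
      idʳ      : ∀ {a b} (f : Hom a b) → (f ∘ id) ≈ f
      assoc    : ∀ {a b c d} (f : Hom c d) (g : Hom b c) (h : Hom a b) → ((f ∘ g) ∘ h) ≈ (f ∘ (g ∘ h))
      !-unique : ∀ {a} (f : Hom a 𝟙) → f ≈ !
      π₁-β     : ∀ {a b c} (f : Hom c a) (g : Hom c b) → (π₁ ∘ ⟨ f , g ⟩) ≈ f
      π₂-β     : ∀ {a b c} (f : Hom c a) (g : Hom c b) → (π₂ ∘ ⟨ f , g ⟩) ≈ g
      ⟨⟩-unique : ∀ {a b c} (h : Hom c (a × b)) (f : Hom c a) (g : Hom c b) →
                  (π₁ ∘ h) ≈ f → (π₂ ∘ h) ≈ g → h ≈ ⟨ f , g ⟩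
      P-poset  : ∀ {c} → IsPartialOrder (_≈P_ {c}) (_≤P_ {c})
      Pmap-mono : ∀ {a b} (f : Hom a b) {x y : PC b} → x ≤P y → Pmap f x ≤P Pmap f y
      Pmap-cong : ∀ {a b} (f : Hom a b) {x y : PC b} → x ≈P y → Pmap f x ≈P Pmap f y
      Pmap-resp : ∀ {a b} {f g : Hom a b} → f ≈ g → ∀ x → Pmap f x ≈P Pmap g x
      Pmap-id  : ∀ {a} (x : PC a) → Pmap (id {a}) x ≈P x
      Pmap-∘   : ∀ {a b c} (g : Hom b c) (f : Hom a b) (x : PC c) → Pmap (g ∘ f) x ≈P Pmap f (Pmap g x)
      conn-cong : ∀ {c n} (o : Conn n) {xs ys : Vec (PC c) n} → Pointwise _≈P_ xs ys → conn o xs ≈P conn o ys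
      Pmap-hom : ∀ {a b n} (f : Hom a b) (o : Conn n) (xs : Vec (PC b) n) →
                 Pmap f (conn o xs) ≈P conn o (Vec.map (Pmap f) xs)
      quant-cong : ∀ (Ω : QSym) b c {x y : PC (b × c)} → x ≈P y → quant Ω b c x ≈P quant Ω b c y
      quant-nat  : ∀ (Ω : QSym) {b b'} c (f : Hom b b') (x : PC (b' × c)) →
                   quant Ω b c (Pmap ⟨ f ∘ π₁ {b} {c} , π₂ {b} {c} ⟩ x) ≈P Pmap f (quant Ω b' c x)
      ⊗-assoc  : ∀ {c} (x y z : PC c) → ((x ⊗ y) ⊗ z) ≈P (x ⊗ (y ⊗ z))
      ⊗-idˡ    : ∀ {c} (x : PC c) → (e c ⊗ x) ≈P x
      ⊗-idʳ    : ∀ {c} (x : PC c) → (x ⊗ e c) ≈P x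
      quant-𝟙  : ∀ (Ω : QSym) b (x : PC b) → quant Ω b 𝟙 (Pmap (π₁ {b} {𝟙}) x) ≈P x
      quant-×  : ∀ (Ω : QSym) b c d (x : PC ((b × c) × d)) →
                 quant Ω b (c × d)
                   (Pmap ⟨ ⟨ π₁ {b} {c × d} , π₁ {c} {d} ∘ π₂ {b} {c × d} ⟩ ,
                           π₂ {c} {d} ∘ π₂ {b} {c × d} ⟩ x)
                 ≈P quant Ω b c (quant Ω (b × c) d x)
      Eq-𝟙     : Eq 𝟙 ≈P e (𝟙 × 𝟙)
      Eq-×     : ∀ c₁ c₂ →
                 Eq (c₁ × c₂) ≈P
                 (Pmap ⟨ π₁ {c₁} {c₂} ∘ π₁ {c₁ × c₂} {c₁ × c₂} , π₁ {c₁} {c₂} ∘ π₂ {c₁ × c₂} {c₁ × c₂} ⟩ (Eq c₁)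
                  ⊗ Pmap ⟨ π₂ {c₁} {c₂} ∘ π₁ {c₁ × c₂} {c₁ × c₂} , π₂ {c₁} {c₂} ∘ π₂ {c₁ × c₂} {c₁ × c₂} ⟩ (Eq c₂))

  FAObj : Set₁
  FAObj = Σ FAData FALaws

module Semantics (L : Language) (Sg : Signature) where
  open Language L
  open Signature Sg
  open Syntax L Sg
  open FA L

  module _ (D : FAData) where
    open FAData D

    prodOf : (Sort → Obj) → List Sort → Obj
    prodOf I [] = 𝟙
    prodOf I (σ ∷ []) = I σ
    prodOf I (σ ∷ τ ∷ Γ) = I σ × prodOf I (τ ∷ Γ)

    record Structure : Set where
      field
        sortI : Sort → Obj
        funI  : ∀ {σs τ} → Fun σs τ → Hom (prodOf sortI σs) (sortI τ)
        relI  : ∀ {σs} → Rel σs → PC (prodOf sortI σs)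

    module Interp (S : Structure) where
      open Structure S

      ⟦_⟧c : Ctx → Obj
      ⟦ Γ ⟧c = prodOf sortI Γ

      proj : ∀ {Γ σ} → σ ∈ Γ → Hom ⟦ Γ ⟧c (sortI σ)
      proj {σ ∷ []} (here refl) = id
      proj {σ ∷ []} (there ())
      proj {σ ∷ τ ∷ Γ} (here refl) = π₁
      proj {σ ∷ τ ∷ Γ} (there i) = proj i ∘ π₂

      mutual
        ⟦_⟧t : ∀ {Γ σ} → Tm Γ σ → Hom ⟦ Γ ⟧c (sortI σ)
        ⟦ var i ⟧t = proj i
        ⟦ app f Ms ⟧t = funI f ∘ ⟦ Ms ⟧ts

        ⟦_⟧ts : ∀ {Γ σs} → Tms Γ σs → Hom ⟦ Γ ⟧c (prodOf sortI σs)
        ⟦ [] ⟧ts = !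
        ⟦ M ∷ [] ⟧ts = ⟦ M ⟧t
        ⟦ M ∷ N ∷ Ms ⟧ts = ⟨ ⟦ M ⟧t , ⟦ N ∷ Ms ⟧ts ⟩

      ext : ∀ Γ σ → Hom (⟦ Γ ⟧c × sortI σ) ⟦ Γ ▹ σ ⟧c
      ext [] σ = π₂
      ext (τ ∷ []) σ = id
      ext (τ ∷ ρ ∷ Γ) σ = ⟨ π₁ ∘ π₁ , ext (ρ ∷ Γ) σ ∘ ⟨ π₂ ∘ π₁ , π₂ ⟩ ⟩

      mutual
        ⟦_⟧f : ∀ {Γ} → Fm Γ → PC ⟦ Γ ⟧c
        ⟦ rel R Ms ⟧f = Pmap ⟦ Ms ⟧ts (relI R)
        ⟦ eq σ M N ⟧f = Pmap ⟨ ⟦ M ⟧t , ⟦ N ⟧t ⟩ (Eq (sortI σ))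
        ⟦ con o φs ⟧f = conn o ⟦ φs ⟧fs
        ⟦ qnt {Γ} Ω σ φ ⟧f = quant Ω ⟦ Γ ⟧c (sortI σ) (Pmap (ext Γ σ) ⟦ φ ⟧f)

        ⟦_⟧fs : ∀ {Γ n} → Vec (Fm Γ) n → Vec (PC ⟦ Γ ⟧c) n
        ⟦ [] ⟧fs = []
        ⟦ φ ∷ φs ⟧fs = ⟦ φ ⟧f ∷ ⟦ φs ⟧fs

      tensor : ∀ {c} → List (PC c) → PC c
      tensor {c} [] = e c
      tensor (x ∷ []) = x
      tensor (x ∷ y ∷ xs) = x ⊗ tensor (y ∷ xs)

      Sat : Assertion → Set
      Sat (eqn Γ τ M N) = ⟦ M ⟧t ≈ ⟦ N ⟧t
      Sat (seq Γ Φ ψ) = tensor (List.map ⟦_⟧f Φ) ≤P ⟦ ψ ⟧f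

    IsModel : Structure → Theory → Set
    IsModel S T = ∀ a → T a → Interp.Sat S a

  Entails : ∀ {k : Level} → (FAObj → Set k) → Theory → Theory → Set (Level.suc Level.zero Level.⊔ k)
  Entails K T T' = ∀ (X : FAObj) → K X → (S : Structure (proj₁ X)) →
                   IsModel (proj₁ X) S T → IsModel (proj₁ X) S T'

module Classifying (L : Language) (Sg : Signature) where
  open Language L
  open Signature Sg
  open Syntax L Sg
  open FA L

  module _ (T : Theory) where

    homEq : ∀ {Δ Γ} → Subst Δ Γ → Subst Δ Γ → Set
    homEq [] [] = ⊤
    homEq {Δ} (_∷_ {σ} M s) (N ∷ s') = T (eqn Δ σ M N) ∧ homEq s s'

    quants : QSym → (Γ Δ : Ctx) → Fm (Γ ++ Δ) → Fm Γ
    quants Ω Γ [] φ = subst Fm (++-identityʳ Γ) φ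
    quants Ω Γ (τ ∷ Δ) φ = qnt Ω τ (quants Ω (Γ ▹ τ) Δ (subst Fm (sym (++-assoc Γ [ τ ] Δ)) φ))

    tensorFm : ∀ {Γ} → List (Fm Γ) → Fm Γ
    tensorFm [] = eF
    tensorFm (φ ∷ []) = φ
    tensorFm (φ ∷ ψ ∷ Φ) = φ ⊗F tensorFm (ψ ∷ Φ)

    eqList : (Γ Δ : Ctx) → Ren Δ Γ → List (Fm (Γ ++ Γ))
    eqList Γ [] r = []
    eqList Γ (σ ∷ Δ) r =
      eq σ (var (∈-++⁺ˡ (r (here refl)))) (var (∈-++⁺ʳ Γ (r (here refl))))
      ∷ eqList Γ Δ (λ i → r (there i))

    EqFm : (Γ : Ctx) → Fm (Γ ++ Γ)
    EqFm Γ = tensorFm (eqList Γ Γ (λ i → i))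

    classData : FAData
    classData = record
      { Obj   = Ctx
      ; Hom   = Subst
      ; _≈_   = homEq
      ; id    = ren (λ i → i)
      ; _∘_   = λ g f → All.map (substTm f) g
      ; 𝟙     = []
      ; !     = []
      ; _×_   = _++_
      ; π₁    = ren ∈-++⁺ˡ
      ; π₂    = λ {a} → ren (∈-++⁺ʳ a)
      ; ⟨_,_⟩ = _++ᴬ_
      ; PC    = Fm
      ; _≈P_  = λ {Γ} φ ψ → T (seq Γ (φ ∷ []) ψ) ∧ T (seq Γ (ψ ∷ []) φ)
      ; _≤P_  = λ {Γ} φ ψ → T (seq Γ (φ ∷ []) ψ)
      ; Pmap  = substFm
      ; conn  = con
      ; Eq    = EqFm
      ; quant = quants
      }

{-# OPTIONS --safe #-}
-- Soundness: interpretation in an FA-object commutes with substitution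
-- (⟦ s φ ⟧ = P⟦ s ⟧⟦ φ ⟧, the quantifier case being naturality of Ω), and
-- then each rule of 𝓛^m is an instance of an FA law.
-- Completeness: the closure of T under 𝓛^m is an 𝓛^m-theory, so its
-- classifying prop-category belongs to 𝒦. Since substitution of provably equal
-- terms is admissible, that category satisfies the FA laws, and in its generic
-- structure every formula denotes itself (renamed along ⟦ Γ ⟧ ≅ Γ). The
-- generic structure is therefore a T-model, and whatever it satisfies is
-- derivable from T.
module Submission where

open import Defs
open import Level using (Level)
open import Data.Nat using (ℕ; zero; suc; _+_)
open import Data.Nat.Properties using (+-assoc; +-comm; +-suc; +-identityʳ; suc-injective; +-cancelˡ-≡)
open import Data.Unit using (⊤; tt)
open import Data.Fin using (Fin) renaming (zero to fz; suc to fs)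
open import Data.Sum using (inj₁; inj₂)
open import Data.Product using (Σ; _,_; proj₁; proj₂; _×_)
open import Data.Vec as Vec using (Vec; []; _∷_)
open import Data.Vec.Relation.Binary.Pointwise.Inductive as Pointwise using (Pointwise; []; _∷_)
open import Data.List as List using (List; []; _∷_; _++_; [_]; length)
open import Data.List.Properties using (++-identityʳ; ++-assoc; length-++; map-++)
open import Data.List.Relation.Unary.Any using (here; there)
open import Data.List.Relation.Unary.Any.Properties using (++⁺∘++⁻)
open import Data.List.Relation.Unary.All as All using (All; []; _∷_)
open import Data.List.Relation.Unary.All.Properties using (lookup-map)
open import Data.List.Membership.Propositional using (_∈_)
open import Data.List.Membership.Propositional.Properties using (∈-++⁺ˡ; ∈-++⁺ʳ; ∈-++⁻)
open import Relation.Binary.PropositionalEquality hiding ([_])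
open import Relation.Binary.Structures using (IsEquivalence; IsPartialOrder)
open import Relation.Binary.Bundles using (Setoid)
import Relation.Binary.Reasoning.Setoid as SetoidReasoning

module _ {A : Set} where

  position : ∀ {x : A} {xs} → x ∈ xs → ℕ
  position (here _) = zero
  position (there i) = suc (position i)

  position-injective : ∀ {x : A} {xs} (i j : x ∈ xs) → position i ≡ position j → i ≡ j
  position-injective (here refl) (here refl) _ = refl
  position-injective (there i) (there j) p = cong there (position-injective i j (suc-injective p))

  position-∈-++⁺ˡ : ∀ {x : A} {xs ys} (i : x ∈ xs) → position (∈-++⁺ˡ {ys = ys} i) ≡ position i
  position-∈-++⁺ˡ (here refl) = refl
  position-∈-++⁺ˡ (there i) = cong suc (position-∈-++⁺ˡ i)

  position-∈-++⁺ʳ : ∀ {x : A} xs {ys} (i : x ∈ ys) → position (∈-++⁺ʳ xs i) ≡ length xs + position i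
  position-∈-++⁺ʳ [] i = refl
  position-∈-++⁺ʳ (y ∷ xs) i = cong suc (position-∈-++⁺ʳ xs i)

  ∈-cast : ∀ {xs ys : List A} → xs ≡ ys → ∀ {x} → x ∈ xs → x ∈ ys
  ∈-cast refl i = i

  position-∈-cast : ∀ {xs ys : List A} (p : xs ≡ ys) {x} (i : x ∈ xs) → position (∈-cast p i) ≡ position i
  position-∈-cast refl i = refl

  ∈-++⁺ˡ-injective : ∀ {x : A} {xs ys} (i j : x ∈ xs) → ∈-++⁺ˡ {ys = ys} i ≡ ∈-++⁺ˡ j → i ≡ j
  ∈-++⁺ˡ-injective i j p = position-injective i j
    (trans (sym (position-∈-++⁺ˡ i)) (trans (cong position p) (position-∈-++⁺ˡ j)))

  ∈-++⁺ʳ-injective : ∀ {x : A} xs {ys} (i j : x ∈ ys) → ∈-++⁺ʳ xs i ≡ ∈-++⁺ʳ xs j → i ≡ j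
  ∈-++⁺ʳ-injective xs i j p = position-injective i j (+-cancelˡ-≡ (length xs) (position i) (position j)
    (trans (sym (position-∈-++⁺ʳ xs i)) (trans (cong position p) (position-∈-++⁺ʳ xs j))))

  data Split (xs ys : List A) {x : A} : x ∈ xs ++ ys → Set where
    inl : (j : x ∈ xs) → Split xs ys (∈-++⁺ˡ j)
    inr : (k : x ∈ ys) → Split xs ys (∈-++⁺ʳ xs k)

  split : ∀ xs {ys} {x : A} (i : x ∈ xs ++ ys) → Split xs ys i
  split [] i = inr i
  split (y ∷ xs) (here p) = inl (here p)
  split (y ∷ xs) (there i) with split xs i
  ... | inl j = inl (there j)
  ... | inr k = inr k

module _ {A : Set} {P : A → Set} where

  lookup-tabulate : ∀ {xs} (f : ∀ {x} → x ∈ xs → P x) {x} (i : x ∈ xs) → All.lookup (All.tabulate f) i ≡ f i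
  lookup-tabulate {_ ∷ _} f (here refl) = refl
  lookup-tabulate {_ ∷ _} f (there i) = lookup-tabulate (λ j → f (there j)) i

  All-ext : ∀ {xs} (a b : All P xs) → (∀ {x} (i : x ∈ xs) → All.lookup a i ≡ All.lookup b i) → a ≡ b
  All-ext [] [] _ = refl
  All-ext (p ∷ a) (q ∷ b) h = cong₂ _∷_ (h (here refl)) (All-ext a b (λ i → h (there i)))

module SubstitutionCalculus (L : Language) (Sg : Signature) where
  open Syntax L Sg

  idS : ∀ {Γ} → Subst Γ Γ
  idS = ren (λ i → i)

  infixr 9 _⊙_
  _⊙_ : ∀ {Ε Δ Γ} → Subst Ε Δ → Subst Δ Γ → Subst Ε Γ
  s ⊙ t = All.map (substTm s) t

  wkS : ∀ {Γ Δ} → Subst (Γ ++ Δ) Γ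
  wkS = ren ∈-++⁺ˡ

  lookup-ren : ∀ {Δ Γ} (ρ : Ren Γ Δ) {σ} (i : σ ∈ Γ) → All.lookup (ren ρ) i ≡ var (ρ i)
  lookup-ren ρ = lookup-tabulate (λ j → var (ρ j))

  lookup-++ᴬˡ : ∀ {Δ Γ Γ'} (s : Subst Δ Γ) (t : Subst Δ Γ') {σ} (i : σ ∈ Γ) →
                All.lookup (s ++ᴬ t) (∈-++⁺ˡ i) ≡ All.lookup s i
  lookup-++ᴬˡ (M ∷ s) t (here refl) = refl
  lookup-++ᴬˡ (M ∷ s) t (there i) = lookup-++ᴬˡ s t i

  lookup-++ᴬʳ : ∀ {Δ Γ Γ'} (s : Subst Δ Γ) (t : Subst Δ Γ') {σ} (i : σ ∈ Γ') →
                All.lookup (s ++ᴬ t) (∈-++⁺ʳ Γ i) ≡ All.lookup t i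
  lookup-++ᴬʳ [] t i = refl
  lookup-++ᴬʳ (M ∷ s) t i = lookup-++ᴬʳ s t i

  lookup-⊙ : ∀ {Ε Δ Γ} (s : Subst Ε Δ) (t : Subst Δ Γ) {σ} (i : σ ∈ Γ) →
             All.lookup (s ⊙ t) i ≡ substTm s (All.lookup t i)
  lookup-⊙ s t i = lookup-map {f = substTm s} t i

  lookup-⊙-ren : ∀ {Ε Δ Γ} (s : Subst Ε Δ) (ρ : Ren Γ Δ) {σ} (i : σ ∈ Γ) →
                 All.lookup (s ⊙ ren ρ) i ≡ All.lookup s (ρ i)
  lookup-⊙-ren s ρ i = trans (lookup-⊙ s (ren ρ) i) (cong (substTm s) (lookup-ren ρ i))

  mutual
    substTm-⊙ : ∀ {Ε Δ Γ σ} (s : Subst Ε Δ) (t : Subst Δ Γ) (M : Tm Γ σ) →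
                substTm s (substTm t M) ≡ substTm (s ⊙ t) M
    substTm-⊙ s t (var i) = sym (lookup-⊙ s t i)
    substTm-⊙ s t (app f Ms) = cong (app f) (substTms-⊙ s t Ms)

    substTms-⊙ : ∀ {Ε Δ Γ σs} (s : Subst Ε Δ) (t : Subst Δ Γ) (Ms : Tms Γ σs) →
                 substTms s (substTms t Ms) ≡ substTms (s ⊙ t) Ms
    substTms-⊙ s t [] = refl
    substTms-⊙ s t (M ∷ Ms) = cong₂ _∷_ (substTm-⊙ s t M) (substTms-⊙ s t Ms)

  mutual
    substTm-id : ∀ {Γ σ} (M : Tm Γ σ) → substTm idS M ≡ M
    substTm-id (var i) = lookup-ren (λ j → j) i
    substTm-id (app f Ms) = cong (app f) (substTms-id Ms)

    substTms-id : ∀ {Γ σs} (Ms : Tms Γ σs) → substTms idS Ms ≡ Ms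
    substTms-id [] = refl
    substTms-id (M ∷ Ms) = cong₂ _∷_ (substTm-id M) (substTms-id Ms)

  ⊙-identityʳ : ∀ {Δ Γ} (s : Subst Δ Γ) → s ⊙ idS ≡ s
  ⊙-identityʳ s = All-ext _ _ (lookup-⊙-ren s (λ j → j))

  ⊙-identityˡ : ∀ {Δ Γ} (s : Subst Δ Γ) → idS ⊙ s ≡ s
  ⊙-identityˡ s = All-ext _ _ λ i → trans (lookup-⊙ idS s i) (substTm-id _)

  ⊙-assoc : ∀ {Z Ε Δ Γ} (r : Subst Z Ε) (s : Subst Ε Δ) (t : Subst Δ Γ) → (r ⊙ s) ⊙ t ≡ r ⊙ (s ⊙ t)
  ⊙-assoc r s t = All-ext _ _ λ i → begin
    All.lookup ((r ⊙ s) ⊙ t) i         ≡⟨ lookup-⊙ (r ⊙ s) t i ⟩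
    substTm (r ⊙ s) (All.lookup t i)   ≡⟨ substTm-⊙ r s (All.lookup t i) ⟨
    substTm r (substTm s (All.lookup t i)) ≡⟨ cong (substTm r) (lookup-⊙ s t i) ⟨
    substTm r (All.lookup (s ⊙ t) i)   ≡⟨ lookup-⊙ r (s ⊙ t) i ⟨
    All.lookup (r ⊙ (s ⊙ t)) i         ∎
    where open ≡-Reasoning

  lookup-lift-∈-++⁺ˡ : ∀ {Δ Γ} (s : Subst Δ Γ) σ {τ} (i : τ ∈ Γ) →
                       All.lookup (lift s σ) (∈-++⁺ˡ i) ≡ substTm wkS (All.lookup s i)
  lookup-lift-∈-++⁺ˡ s σ i = trans (lookup-++ᴬˡ (wkS ⊙ s) _ i) (lookup-⊙ wkS s i)

  lookup-lift-last : ∀ {Δ Γ} (s : Subst Δ Γ) σ →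
                     All.lookup (lift s σ) (∈-++⁺ʳ Γ (here refl)) ≡ var (∈-++⁺ʳ Δ (here refl))
  lookup-lift-last s σ = lookup-++ᴬʳ (wkS ⊙ s) _ (here refl)

  ▹-ext : ∀ {Δ Γ σ} (a b : Subst (Δ ▹ σ) (Γ ▹ σ)) →
          (∀ {τ} (i : τ ∈ Γ) → All.lookup a (∈-++⁺ˡ i) ≡ All.lookup b (∈-++⁺ˡ i)) →
          All.lookup a (∈-++⁺ʳ Γ (here refl)) ≡ All.lookup b (∈-++⁺ʳ Γ (here refl)) →
          a ≡ b
  ▹-ext {Γ = Γ} a b old new = All-ext a b pointwise
    where
    pointwise : ∀ {τ} (i : τ ∈ _) → All.lookup a i ≡ All.lookup b i
    pointwise i with split Γ i
    ... | inl j = old j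
    ... | inr (here refl) = new

  lift-⊙-wkS : ∀ {Ε Δ σ} (s : Subst Ε Δ) → lift s σ ⊙ wkS ≡ wkS ⊙ s
  lift-⊙-wkS s = All-ext _ _ λ i →
    trans (lookup-⊙-ren _ ∈-++⁺ˡ i) (trans (lookup-lift-∈-++⁺ˡ s _ i) (sym (lookup-⊙ wkS s i)))

  lift-⊙ : ∀ {Ε Δ Γ} (s : Subst Ε Δ) (t : Subst Δ Γ) σ → lift s σ ⊙ lift t σ ≡ lift (s ⊙ t) σ
  lift-⊙ {Ε} {Δ} s t σ = ▹-ext _ _ old new
    where
    open ≡-Reasoning
    wkΔ : Subst (Δ ▹ σ) Δ
    wkΔ = wkS
    wkΕ : Subst (Ε ▹ σ) Ε
    wkΕ = wkS
    old : ∀ {τ} i → All.lookup (lift s σ ⊙ lift t σ) (∈-++⁺ˡ {v = τ} i) ≡ All.lookup (lift (s ⊙ t) σ) (∈-++⁺ˡ i)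
    old i = begin
      All.lookup (lift s σ ⊙ lift t σ) (∈-++⁺ˡ i)         ≡⟨ lookup-⊙ (lift s σ) (lift t σ) _ ⟩
      substTm (lift s σ) (All.lookup (lift t σ) (∈-++⁺ˡ i)) ≡⟨ cong (substTm (lift s σ)) (lookup-lift-∈-++⁺ˡ t σ i) ⟩
      substTm (lift s σ) (substTm wkΔ (All.lookup t i))   ≡⟨ substTm-⊙ (lift s σ) wkΔ (All.lookup t i) ⟩
      substTm (lift s σ ⊙ wkΔ) (All.lookup t i)           ≡⟨ cong (λ u → substTm u (All.lookup t i)) (lift-⊙-wkS s) ⟩
      substTm (wkΕ ⊙ s) (All.lookup t i)                  ≡⟨ substTm-⊙ wkΕ s (All.lookup t i) ⟨
      substTm wkΕ (substTm s (All.lookup t i))            ≡⟨ cong (substTm wkΕ) (lookup-⊙ s t i) ⟨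
      substTm wkΕ (All.lookup (s ⊙ t) i)                  ≡⟨ lookup-lift-∈-++⁺ˡ (s ⊙ t) σ i ⟨
      All.lookup (lift (s ⊙ t) σ) (∈-++⁺ˡ i)              ∎
    new : All.lookup (lift s σ ⊙ lift t σ) _ ≡ All.lookup (lift (s ⊙ t) σ) _
    new = trans (lookup-⊙ (lift s σ) (lift t σ) _)
      (trans (cong (substTm (lift s σ)) (lookup-lift-last t σ))
      (trans (lookup-lift-last s σ) (sym (lookup-lift-last (s ⊙ t) σ))))

  lift-id : ∀ {Γ} σ → lift (idS {Γ}) σ ≡ idS
  lift-id σ = ▹-ext _ _
    (λ i → trans (lookup-lift-∈-++⁺ˡ idS σ i) (trans (cong (substTm wkS) (lookup-ren (λ j → j) i))
           (trans (lookup-ren ∈-++⁺ˡ i) (sym (lookup-ren (λ j → j) (∈-++⁺ˡ i))))))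
    (trans (lookup-lift-last idS σ) (sym (lookup-ren (λ j → j) _)))

  mutual
    substFm-⊙ : ∀ {Ε Δ Γ} (s : Subst Ε Δ) (t : Subst Δ Γ) (φ : Fm Γ) →
                substFm s (substFm t φ) ≡ substFm (s ⊙ t) φ
    substFm-⊙ s t (rel R Ms) = cong (rel R) (substTms-⊙ s t Ms)
    substFm-⊙ s t (eq σ M N) = cong₂ (eq σ) (substTm-⊙ s t M) (substTm-⊙ s t N)
    substFm-⊙ s t (con o φs) = cong (con o) (substFms-⊙ s t φs)
    substFm-⊙ s t (qnt Ω σ φ) = cong (qnt Ω σ)
      (trans (substFm-⊙ (lift s σ) (lift t σ) φ) (cong (λ u → substFm u φ) (lift-⊙ s t σ)))

    substFms-⊙ : ∀ {Ε Δ Γ n} (s : Subst Ε Δ) (t : Subst Δ Γ) (φs : Vec (Fm Γ) n) →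
                 substFms s (substFms t φs) ≡ substFms (s ⊙ t) φs
    substFms-⊙ s t [] = refl
    substFms-⊙ s t (φ ∷ φs) = cong₂ _∷_ (substFm-⊙ s t φ) (substFms-⊙ s t φs)

  mutual
    substFm-id : ∀ {Γ} (φ : Fm Γ) → substFm idS φ ≡ φ
    substFm-id (rel R Ms) = cong (rel R) (substTms-id Ms)
    substFm-id (eq σ M N) = cong₂ (eq σ) (substTm-id M) (substTm-id N)
    substFm-id (con o φs) = cong (con o) (substFms-id φs)
    substFm-id (qnt Ω σ φ) = cong (qnt Ω σ) (trans (cong (λ u → substFm u φ) (lift-id σ)) (substFm-id φ))

    substFms-id : ∀ {Γ n} (φs : Vec (Fm Γ) n) → substFms idS φs ≡ φs
    substFms-id [] = refl
    substFms-id (φ ∷ φs) = cong₂ _∷_ (substFm-id φ) (substFms-id φs)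

  substFms≡map : ∀ {Δ Γ n} (s : Subst Δ Γ) (φs : Vec (Fm Γ) n) → substFms s φs ≡ Vec.map (substFm s) φs
  substFms≡map s [] = refl
  substFms≡map s (φ ∷ φs) = cong (substFm s φ ∷_) (substFms≡map s φs)

  subst-Fm≡ren : ∀ {Γ Δ} (p : Γ ≡ Δ) (φ : Fm Γ) → subst Fm p φ ≡ substFm (ren (∈-cast p)) φ
  subst-Fm≡ren refl φ = sym (substFm-id φ)

  -- The function tabulated by sub1 is local to its definition; matching the
  -- equation sub1 Γ N ≡ All.tabulate f against refl is how f is reached.
  lookup-tabulated : ∀ {Δ Γ} {f : ∀ {σ} → σ ∈ Γ → Tm Δ σ} (s : Subst Δ Γ) → s ≡ All.tabulate f →
                     ∀ {σ} (i : σ ∈ Γ) → All.lookup s i ≡ f i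
  lookup-tabulated s refl = lookup-tabulate _

  sub1≡ : ∀ Γ {Γ' σ} (N : Tm (Γ ++ Γ') σ) → sub1 Γ N ≡ wkS {Γ} {Γ'} ++ᴬ (N ∷ ren (∈-++⁺ʳ Γ))
  sub1≡ Γ {Γ'} {σ} N = All-ext _ _ pointwise
    where
    s = wkS {Γ} {Γ'}
    t = N ∷ ren (∈-++⁺ʳ Γ)
    pointwise : ∀ {τ} (i : τ ∈ Γ ++ σ ∷ Γ') → All.lookup (sub1 Γ N) i ≡ All.lookup (s ++ᴬ t) i
    pointwise i with ∈-++⁻ Γ {σ ∷ Γ'} i | lookup-tabulated (sub1 Γ N) refl i | ++⁺∘++⁻ Γ {σ ∷ Γ'} i
    ... | inj₁ j | e | refl = trans e (sym (trans (lookup-++ᴬˡ s t j) (lookup-ren ∈-++⁺ˡ j)))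
    ... | inj₂ (here refl) | e | refl = trans e (sym (lookup-++ᴬʳ s t (here refl)))
    ... | inj₂ (there k) | e | refl = trans e (sym (trans (lookup-++ᴬʳ s t (there k)) (lookup-ren (∈-++⁺ʳ Γ) k)))

  -- The structural substitutions (weakenings, transports along context
  -- equations, product projections) are shifts, and a shift by 0 is determined
  -- by its type; this decides every equation between composites of them.
  record IsShift (k : ℕ) {Δ Γ} (s : Subst Δ Γ) : Set where
    constructor mkShift
    field shift : ∀ {σ} (i : σ ∈ Γ) → Σ (σ ∈ Δ) λ j → (All.lookup s i ≡ var j) × (position j ≡ k + position i)
  open IsShift

  shift-ren : ∀ k {Δ Γ} (ρ : Ren Γ Δ) → (∀ {σ} (i : σ ∈ Γ) → position (ρ i) ≡ k + position i) → IsShift k (ren ρ)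
  shift-ren k ρ h = mkShift λ i → ρ i , lookup-ren ρ i , h i

  shift-idS : ∀ {Γ} → IsShift 0 (idS {Γ})
  shift-idS = shift-ren 0 (λ i → i) (λ i → refl)

  shift-wkS : ∀ {Γ Δ} → IsShift 0 (wkS {Γ} {Δ})
  shift-wkS = shift-ren 0 ∈-++⁺ˡ position-∈-++⁺ˡ

  shift-∈-++⁺ʳ : ∀ Γ {Δ} → IsShift (length Γ) (ren {Γ ++ Δ} (∈-++⁺ʳ Γ))
  shift-∈-++⁺ʳ Γ = shift-ren (length Γ) (∈-++⁺ʳ Γ) (position-∈-++⁺ʳ Γ)

  shift-cast : ∀ {Γ Δ} (p : Γ ≡ Δ) → IsShift 0 (ren (∈-cast p))
  shift-cast p = shift-ren 0 (∈-cast p) (position-∈-cast p)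

  shift-offset : ∀ {k m Δ Γ} {s : Subst Δ Γ} → k ≡ m → IsShift k s → IsShift m s
  shift-offset refl o = o

  shift-⊙ : ∀ {k m Ε Δ Γ} {t : Subst Ε Δ} {s : Subst Δ Γ} → IsShift m t → IsShift k s → IsShift (m + k) (t ⊙ s)
  shift-⊙ {k} {m} {t = t} {s} ot os = mkShift composite
    where
    composite : ∀ {σ} (i : σ ∈ _) → _
    composite i with shift os i
    ... | j , s≡j , pj with shift ot j
    ... | l , t≡l , pl = l , trans (lookup-⊙ t s i) (trans (cong (substTm t) s≡j) t≡l) ,
                         trans pl (trans (cong (m +_) pj) (sym (+-assoc m k (position i))))

  shift-++ᴬ : ∀ {k Δ Γ Γ'} {s : Subst Δ Γ} {t : Subst Δ Γ'} →
              IsShift k s → IsShift (k + length Γ) t → IsShift k (s ++ᴬ t)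
  shift-++ᴬ {k} {Γ = Γ} {s = s} {t} os ot = mkShift pointwise
    where
    pointwise : ∀ {σ} (i : σ ∈ _) → _
    pointwise i with split Γ i
    ... | inl j with shift os j
    ...   | l , e , d = l , trans (lookup-++ᴬˡ s t j) e , trans d (cong (k +_) (sym (position-∈-++⁺ˡ j)))
    pointwise i | inr j with shift ot j
    ...   | l , e , d = l , trans (lookup-++ᴬʳ s t j) e ,
            trans d (trans (+-assoc k (length Γ) (position j)) (cong (k +_) (sym (position-∈-++⁺ʳ Γ j))))

  shift-lift : ∀ {Δ Γ} {s : Subst Δ Γ} σ → IsShift 0 s → length Δ ≡ length Γ → IsShift 0 (lift s σ)
  shift-lift {Δ} {Γ} {s} σ os len = mkShift pointwise
    where
    pointwise : ∀ {τ} (i : τ ∈ Γ ▹ σ) → _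
    pointwise i with split Γ i
    ... | inl j with shift os j
    ...   | l , e , d = ∈-++⁺ˡ l ,
            trans (lookup-lift-∈-++⁺ˡ s σ j) (trans (cong (substTm wkS) e) (lookup-ren ∈-++⁺ˡ l)) ,
            trans (position-∈-++⁺ˡ l) (trans d (sym (position-∈-++⁺ˡ j)))
    pointwise i | inr (here refl) =
      ∈-++⁺ʳ Δ (here refl) , lookup-lift-last s σ ,
      trans (position-∈-++⁺ʳ Δ (here refl)) (trans (cong (_+ 0) len) (sym (position-∈-++⁺ʳ Γ (here refl))))

  shift0-unique : ∀ {Δ Γ} {s t : Subst Δ Γ} → IsShift 0 s → IsShift 0 t → s ≡ t
  shift0-unique {s = s} {t} os ot = All-ext s t pointwise
    where
    pointwise : ∀ {σ} (i : σ ∈ _) → All.lookup s i ≡ All.lookup t i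
    pointwise i with shift os i | shift ot i
    ... | j , s≡j , pj | l , t≡l , pl = trans s≡j (trans (cong var (position-injective j l (trans pj (sym pl)))) (sym t≡l))

module DerivedRules (L : Language) (Sg : Signature) (T : Syntax.Theory L Sg) where
  open Syntax L Sg
  open SubstitutionCalculus L Sg
  open Classifying L Sg using (homEq; tensorFm)

  HomEq : ∀ {Δ Γ} → Subst Δ Γ → Subst Δ Γ → Set
  HomEq = homEq (Der T)

  ⨂ : ∀ {Γ} → List (Fm Γ) → Fm Γ
  ⨂ = tensorFm (Der T)

  substList : ∀ {Δ Γ} → Subst Δ Γ → List (Fm Γ) → List (Fm Δ)
  substList s = List.map (substFm s)

  substList-⊙ : ∀ {Ε Δ Γ} (s : Subst Ε Δ) (t : Subst Δ Γ) (Φ : List (Fm Γ)) →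
                substList s (substList t Φ) ≡ substList (s ⊙ t) Φ
  substList-⊙ s t [] = refl
  substList-⊙ s t (φ ∷ Φ) = cong₂ _∷_ (substFm-⊙ s t φ) (substList-⊙ s t Φ)

  substList-id : ∀ {Γ} (Φ : List (Fm Γ)) → substList idS Φ ≡ Φ
  substList-id [] = refl
  substList-id (φ ∷ Φ) = cong₂ _∷_ (substFm-id φ) (substList-id Φ)

  cast-seq : ∀ {Γ Φ Φ' ψ ψ'} → Φ ≡ Φ' → ψ ≡ ψ' → Der T (seq Γ Φ ψ) → Der T (seq Γ Φ' ψ')
  cast-seq refl refl d = d

  cast-eqn : ∀ {Γ τ M M' N N'} → M ≡ M' → N ≡ N' → Der T (eqn Γ τ M N) → Der T (eqn Γ τ M' N')
  cast-eqn refl refl d = d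

  seq-substS : ∀ {Δ Γ Φ ψ} {s t : Subst Δ Γ} → s ≡ t → Der T (seq Δ (substList s Φ) (substFm s ψ)) →
               Der T (seq Δ (substList t Φ) (substFm t ψ))
  seq-substS refl d = d

  rename-context : ∀ {Γ Γ' Φ ψ} (p : Γ ≡ Γ') → Der T (seq Γ Φ ψ) →
                   Der T (seq Γ' (substList (ren (∈-cast p)) Φ) (substFm (ren (∈-cast p)) ψ))
  rename-context {Φ = Φ} {ψ} refl = cast-seq (sym (substList-id Φ)) (sym (substFm-id ψ))

  weaken : ∀ Δ {Γ Φ ψ} → Der T (seq Γ Φ ψ) → Der T (seq (Γ ++ Δ) (substList wkS Φ) (substFm wkS ψ))
  weaken [] {Γ} d = seq-substS (shift0-unique (shift-cast _) shift-wkS) (rename-context (sym (++-identityʳ Γ)) d)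
  weaken (δ ∷ Δ) {Γ} {Φ} {ψ} d =
    seq-substS (shift0-unique (shift-⊙ (shift-cast _) (shift-⊙ shift-wkS shift-wkS)) shift-wkS)
      (cast-seq (trans (cong (substList _) (substList-⊙ _ _ Φ)) (substList-⊙ _ _ Φ))
                (trans (cong (substFm _) (substFm-⊙ _ _ ψ)) (substFm-⊙ _ _ ψ))
        (rename-context (++-assoc Γ [ δ ] Δ) (weaken Δ (cwk δ d))))

  weaken-eqn : ∀ Δ {Γ τ M N} → Der T (eqn Γ τ M N) → Der T (eqn (Γ ++ Δ) τ (substTm wkS M) (substTm wkS N))
  weaken-eqn Δ d = e-sub [] _ (∈-++⁺ˡ , ∈-++⁺ˡ-injective) d (e-refl (var (here refl)))

  sub1-⊙-prefix : ∀ {σ} Γ {Δ} (s : Subst Δ Γ) (M : Tm Δ σ) →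
                  (s ++ᴬ idS) ⊙ sub1 [] (substTm (ren (∈-++⁺ʳ Γ)) M) ≡ M ∷ (s ++ᴬ idS)
  sub1-⊙-prefix Γ {Δ} s M = All-ext _ _ pointwise
    where
    s⁺ : Subst Δ (Γ ++ Δ)
    s⁺ = s ++ᴬ idS
    s⁺-on-Δ : s⁺ ⊙ ren (∈-++⁺ʳ Γ) ≡ idS
    s⁺-on-Δ = All-ext _ _ λ i → trans (lookup-⊙-ren _ _ i) (lookup-++ᴬʳ s idS i)
    pointwise : ∀ {τ} (i : τ ∈ _) → All.lookup (s⁺ ⊙ sub1 [] (substTm (ren (∈-++⁺ʳ Γ)) M)) i ≡ All.lookup (M ∷ s⁺) i
    pointwise (here refl) = trans (substTm-⊙ s⁺ (ren (∈-++⁺ʳ Γ)) M)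
      (trans (cong (λ u → substTm u M) s⁺-on-Δ) (substTm-id M))
    pointwise (there i) = trans (lookup-⊙ s⁺ (sub1 [] (substTm (ren (∈-++⁺ʳ Γ)) M)) (there i)) (cong (substTm s⁺) (lookup-ren (λ j → j) i))

  private
    front : ∀ Γ {Δ} → InjRen Δ (Γ ++ Δ)
    front Γ = ∈-++⁺ʳ Γ , ∈-++⁺ʳ-injective Γ

  subst-prefix : ∀ Γ {Δ} (s s' : Subst Δ Γ) → HomEq s s' → ∀ {Φ ψ} → Der T (seq (Γ ++ Δ) Φ ψ) →
                 Der T (seq Δ (substList (s ++ᴬ idS) Φ) (substFm (s' ++ᴬ idS) ψ))
  subst-prefix [] [] [] _ {Φ} {ψ} = cast-seq (sym (substList-id Φ)) (sym (substFm-id ψ))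
  subst-prefix (σ ∷ Γ) {Δ} (M ∷ s) (M' ∷ s') (M≡M' , s≡s') {Φ} {ψ} d =
    cast-seq (trans (substList-⊙ _ _ Φ) (cong (λ u → substList u Φ) (sub1-⊙-prefix Γ s M)))
             (trans (substFm-⊙ _ _ ψ) (cong (λ u → substFm u ψ) (sub1-⊙-prefix Γ s' M')))
      (subst-prefix Γ s s' s≡s' (sub [] (Γ ++ Δ) (front Γ) M≡M' d))

  subst-prefix-eqn : ∀ Γ {Δ} (s s' : Subst Δ Γ) → HomEq s s' → ∀ {τ M N} → Der T (eqn (Γ ++ Δ) τ M N) →
                     Der T (eqn Δ τ (substTm (s ++ᴬ idS) M) (substTm (s' ++ᴬ idS) N))
  subst-prefix-eqn [] [] [] _ {M = M} {N} = cast-eqn (sym (substTm-id M)) (sym (substTm-id N))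
  subst-prefix-eqn (σ ∷ Γ) {Δ} (P ∷ s) (P' ∷ s') (P≡P' , s≡s') {M = M} {N} d =
    cast-eqn (trans (substTm-⊙ _ _ M) (cong (λ u → substTm u M) (sub1-⊙-prefix Γ s P)))
             (trans (substTm-⊙ _ _ N) (cong (λ u → substTm u N) (sub1-⊙-prefix Γ s' P')))
      (subst-prefix-eqn Γ s s' s≡s' (e-sub [] (Γ ++ Δ) (front Γ) P≡P' d))

  ++ᴬ-idS-⊙-wkS : ∀ {Δ Γ} (s : Subst Δ Γ) → (s ++ᴬ idS) ⊙ wkS ≡ s
  ++ᴬ-idS-⊙-wkS s = All-ext _ _ λ i → trans (lookup-⊙-ren _ _ i) (lookup-++ᴬˡ s idS i)

  -- The rule Sub replaces a single variable: weaken by Δ, then eliminate the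
  -- variables of Γ one at a time.
  subst-seq : ∀ {Γ Δ} (s s' : Subst Δ Γ) → HomEq s s' → ∀ {Φ ψ} → Der T (seq Γ Φ ψ) →
              Der T (seq Δ (substList s Φ) (substFm s' ψ))
  subst-seq {Γ} {Δ} s s' s≡s' {Φ} {ψ} d =
    cast-seq (trans (substList-⊙ _ _ Φ) (cong (λ u → substList u Φ) (++ᴬ-idS-⊙-wkS s)))
             (trans (substFm-⊙ _ _ ψ) (cong (λ u → substFm u ψ) (++ᴬ-idS-⊙-wkS s')))
      (subst-prefix Γ s s' s≡s' (weaken Δ d))

  subst-eqn : ∀ {Γ Δ} (s s' : Subst Δ Γ) → HomEq s s' → ∀ {τ M N} → Der T (eqn Γ τ M N) →
              Der T (eqn Δ τ (substTm s M) (substTm s' N))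
  subst-eqn {Γ} {Δ} s s' s≡s' {M = M} {N} d =
    cast-eqn (trans (substTm-⊙ _ _ M) (cong (λ u → substTm u M) (++ᴬ-idS-⊙-wkS s)))
             (trans (substTm-⊙ _ _ N) (cong (λ u → substTm u N) (++ᴬ-idS-⊙-wkS s')))
      (subst-prefix-eqn Γ s s' s≡s' (weaken-eqn Δ d))

  homEq-refl : ∀ {Δ Γ} (s : Subst Δ Γ) → HomEq s s
  homEq-refl [] = tt
  homEq-refl (M ∷ s) = e-refl M , homEq-refl s

  homEq-reflexive : ∀ {Δ Γ} {s s' : Subst Δ Γ} → s ≡ s' → HomEq s s'
  homEq-reflexive {s = s} refl = homEq-refl s

  homEq-sym : ∀ {Δ Γ} {s s' : Subst Δ Γ} → HomEq s s' → HomEq s' s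
  homEq-sym {s = []} {[]} _ = tt
  homEq-sym {s = M ∷ s} {M' ∷ s'} (e , h) = e-sym e , homEq-sym h

  homEq-trans : ∀ {Δ Γ} {s s' s'' : Subst Δ Γ} → HomEq s s' → HomEq s' s'' → HomEq s s''
  homEq-trans {s = []} {[]} {[]} _ _ = tt
  homEq-trans {s = M ∷ s} {M' ∷ s'} {M'' ∷ s''} (e , h) (e' , h') = e-trans e e' , homEq-trans h h'

  homEq-⊙ : ∀ {Ε Δ Γ} {f f' : Subst Δ Γ} {g g' : Subst Ε Δ} → HomEq f f' → HomEq g g' → HomEq (g ⊙ f) (g' ⊙ f')
  homEq-⊙ {f = []} {[]} _ _ = tt
  homEq-⊙ {f = M ∷ f} {M' ∷ f'} {g} {g'} (e , h) k = subst-eqn g g' k e , homEq-⊙ h k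

  homEq-++ᴬ : ∀ {Δ Γ Γ'} {s s' : Subst Δ Γ} {t t' : Subst Δ Γ'} → HomEq s s' → HomEq t t' → HomEq (s ++ᴬ t) (s' ++ᴬ t')
  homEq-++ᴬ {s = []} {[]} _ k = k
  homEq-++ᴬ {s = M ∷ s} {M' ∷ s'} (e , h) k = e , homEq-++ᴬ h k

  cast-hyps : ∀ {Γ Φ Φ' θ} → Φ ≡ Φ' → Der T (seq Γ Φ θ) → Der T (seq Γ Φ' θ)
  cast-hyps refl d = d

  tensor-intro : ∀ {Γ} (Φ Ψ Ξ : List (Fm Γ)) θ → Der T (seq Γ (Φ ++ Ψ ++ Ξ) θ) → Der T (seq Γ (Φ ++ ⨂ Ψ ∷ Ξ) θ)
  tensor-intro Φ [] Ξ θ d = e-ref⇐ Φ Ξ θ d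
  tensor-intro Φ (a ∷ []) Ξ θ d = d
  tensor-intro Φ (a ∷ b ∷ Ψ) Ξ θ d =
    ⊗-ref⇒ Φ a (⨂ (b ∷ Ψ)) Ξ θ
      (cast-hyps (++-assoc Φ [ a ] _) (tensor-intro (Φ ++ [ a ]) (b ∷ Ψ) Ξ θ (cast-hyps (sym (++-assoc Φ [ a ] _)) d)))

  tensor-elim : ∀ {Γ} (Φ Ψ Ξ : List (Fm Γ)) θ → Der T (seq Γ (Φ ++ ⨂ Ψ ∷ Ξ) θ) → Der T (seq Γ (Φ ++ Ψ ++ Ξ) θ)
  tensor-elim Φ [] Ξ θ d = e-ref⇒ Φ Ξ θ d
  tensor-elim Φ (a ∷ []) Ξ θ d = d
  tensor-elim Φ (a ∷ b ∷ Ψ) Ξ θ d =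
    cast-hyps (++-assoc Φ [ a ] _) (tensor-elim (Φ ++ [ a ]) (b ∷ Ψ) Ξ θ
      (cast-hyps (sym (++-assoc Φ [ a ] _)) (⊗-ref⇐ Φ a (⨂ (b ∷ Ψ)) Ξ θ d)))

  tensor-intro₁ : ∀ {Γ} (Φ : List (Fm Γ)) θ → Der T (seq Γ Φ θ) → Der T (seq Γ (⨂ Φ ∷ []) θ)
  tensor-intro₁ Φ θ d = tensor-intro [] Φ [] θ (cast-hyps (sym (++-identityʳ Φ)) d)

  tensor-elim₁ : ∀ {Γ} (Φ : List (Fm Γ)) θ → Der T (seq Γ (⨂ Φ ∷ []) θ) → Der T (seq Γ Φ θ)
  tensor-elim₁ Φ θ d = cast-hyps (++-identityʳ Φ) (tensor-elim [] Φ [] θ d)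

  infix 4 _≅_
  _≅_ : ∀ {Γ} → Fm Γ → Fm Γ → Set
  _≅_ {Γ} φ ψ = Der T (seq Γ (φ ∷ []) ψ) × Der T (seq Γ (ψ ∷ []) φ)

  ≅-refl : ∀ {Γ} (φ : Fm Γ) → φ ≅ φ
  ≅-refl φ = ax φ , ax φ

  ≅-reflexive : ∀ {Γ} {φ ψ : Fm Γ} → φ ≡ ψ → φ ≅ ψ
  ≅-reflexive {φ = φ} refl = ≅-refl φ

  ≅-sym : ∀ {Γ} {φ ψ : Fm Γ} → φ ≅ ψ → ψ ≅ φ
  ≅-sym (a , b) = b , a

  ≅-trans : ∀ {Γ} {φ ψ θ : Fm Γ} → φ ≅ ψ → ψ ≅ θ → φ ≅ θ
  ≅-trans (a , b) (c , d) = cut a c , cut d b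

  ⊗F-assoc : ∀ {Γ} (x y z : Fm Γ) → ((x ⊗F y) ⊗F z) ≅ (x ⊗F (y ⊗F z))
  ⊗F-assoc x y z =
    ⊗-ref⇒ [] (x ⊗F y) z [] _ (⊗-ref⇒ [] x y (z ∷ []) _ (⊗-ref⇐ (x ∷ []) y z [] _ (⊗-ref⇐ [] x (y ⊗F z) [] _ (ax _)))) ,
    ⊗-ref⇒ [] x (y ⊗F z) [] _ (⊗-ref⇒ (x ∷ []) y z [] _ (⊗-ref⇐ [] x y (z ∷ []) _ (⊗-ref⇐ [] (x ⊗F y) z [] _ (ax _))))

  ⊗F-identityˡ : ∀ {Γ} (x : Fm Γ) → (eF ⊗F x) ≅ x
  ⊗F-identityˡ x = ⊗-ref⇒ [] eF x [] x (e-ref⇐ [] (x ∷ []) x (ax x)) ,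
                   e-ref⇒ [] (x ∷ []) _ (⊗-ref⇐ [] eF x [] _ (ax _))

  ⊗F-identityʳ : ∀ {Γ} (x : Fm Γ) → (x ⊗F eF) ≅ x
  ⊗F-identityʳ x = ⊗-ref⇒ [] x eF [] x (e-ref⇐ (x ∷ []) [] x (ax x)) ,
                   e-ref⇒ (x ∷ []) [] _ (⊗-ref⇐ [] x eF [] _ (ax _))

  ⨂-++ : ∀ {Γ} (A B : List (Fm Γ)) → ⨂ (A ++ B) ≅ (⨂ A ⊗F ⨂ B)
  ⨂-++ A B =
    tensor-intro₁ (A ++ B) _ (cast-hyps (cong (A ++_) (++-identityʳ B))
      (tensor-elim A B [] _ (tensor-elim [] A (⨂ B ∷ []) _ (⊗-ref⇐ [] (⨂ A) (⨂ B) [] _ (ax _))))) ,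
    ⊗-ref⇒ [] (⨂ A) (⨂ B) [] _ (tensor-intro [] A (⨂ B ∷ []) _ (tensor-intro A B [] _
      (cast-hyps (sym (cong (A ++_) (++-identityʳ B))) (tensor-elim₁ (A ++ B) _ (ax _)))))

  Der-isLmTheory : IsLmTheory (Der T)
  Der-isLmTheory _ = closed
    where
    closed : ∀ {a} → Der (Der T) a → Der T a
    closed (hyp d) = d
    closed (e-refl M) = e-refl M
    closed (e-sym d) = e-sym (closed d)
    closed (e-trans d d′) = e-trans (closed d) (closed d′)
    closed (e-sub Γ Γ' ρ d d′) = e-sub Γ Γ' ρ (closed d) (closed d′)
    closed (ax φ) = ax φ
    closed (cut d d′) = cut (closed d) (closed d′)
    closed (cwk σ d) = cwk σ (closed d)
    closed (sub Γ Γ' ρ d d′) = sub Γ Γ' ρ (closed d) (closed d′)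
    closed (Ω-con Ω d d′) = Ω-con Ω (closed d) (closed d′)
    closed (◇-cong o φs ψs d d′) = ◇-cong o φs ψs (λ i → closed (d i)) (λ i → closed (d′ i))
    closed (⊗-ref⇒ Φ α β Ψ θ d) = ⊗-ref⇒ Φ α β Ψ θ (closed d)
    closed (⊗-ref⇐ Φ α β Ψ θ d) = ⊗-ref⇐ Φ α β Ψ θ (closed d)
    closed (e-ref⇒ Φ Ψ φ d) = e-ref⇒ Φ Ψ φ (closed d)
    closed (e-ref⇐ Φ Ψ φ d) = e-ref⇐ Φ Ψ φ (closed d)

module ClassifyingLaws (L : Language) (Sg : Signature) (T : Syntax.Theory L Sg) where
  open Language L
  open Signature Sg
  open Syntax L Sg
  open SubstitutionCalculus L Sg
  open DerivedRules L Sg T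
  open FA L
  open Classifying L Sg using (classData; quants; eqList; EqFm)

  ClassData : FAData
  ClassData = classData (Der T)

  quantify : QSym → (Γ Δ : Ctx) → Fm (Γ ++ Δ) → Fm Γ
  quantify = quants (Der T)

  var-≡ : ∀ {Γ σ} (v w : σ ∈ Γ) → position v ≡ position w → var v ≡ var w
  var-≡ v w p = cong var (position-injective v w p)

  subst-≅ : ∀ {Γ Γ'} (p : Γ ≡ Γ') {x y : Fm Γ} → x ≅ y → subst Fm p x ≅ subst Fm p y
  subst-≅ refl h = h

  quantify-cong : ∀ Ω Γ Δ {x y : Fm (Γ ++ Δ)} → x ≅ y → quantify Ω Γ Δ x ≅ quantify Ω Γ Δ y
  quantify-cong Ω Γ [] h = subst-≅ (++-identityʳ Γ) h
  quantify-cong Ω Γ (τ ∷ Δ) h =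
    let (x⊢y , y⊢x) = quantify-cong Ω (Γ ▹ τ) Δ (subst-≅ (sym (++-assoc Γ [ τ ] Δ)) h)
    in Ω-con Ω x⊢y y⊢x , Ω-con Ω y⊢x x⊢y

  subst-quantify : ∀ Ω {Γ Γ'} (p : Γ ≡ Γ') Δ (x : Fm (Γ ++ Δ)) →
                   subst Fm p (quantify Ω Γ Δ x) ≡ quantify Ω Γ' Δ (subst Fm (cong (_++ Δ) p) x)
  subst-quantify Ω refl Δ x = refl

  substFm-shift : ∀ {Δ Γ} {s t : Subst Δ Γ} → IsShift 0 s → IsShift 0 t → ∀ φ → substFm s φ ≡ substFm t φ
  substFm-shift os ot φ = cong (λ u → substFm u φ) (shift0-unique os ot)

  quantify-++ : ∀ Ω c b d {S : Subst (b ++ (c ++ d)) ((b ++ c) ++ d)} → IsShift 0 S → (x : Fm ((b ++ c) ++ d)) →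
          quantify Ω b (c ++ d) (substFm S x) ≡ quantify Ω b c (quantify Ω (b ++ c) d x)
  quantify-++ Ω [] b d oS x = sym (trans (subst-quantify Ω (++-identityʳ b) d x)
    (cong (quantify Ω b d) (trans (subst-Fm≡ren _ x) (substFm-shift (shift-cast _) oS x))))
  quantify-++ Ω (τ ∷ c) b d {S} oS x = cong (qnt Ω τ) (begin
    quantify Ω (b ▹ τ) (c ++ d) (subst Fm (sym (++-assoc b [ τ ] (c ++ d))) (substFm S x))
      ≡⟨ cong (quantify Ω (b ▹ τ) (c ++ d)) reassociate ⟩
    quantify Ω (b ▹ τ) (c ++ d) (substFm S′ x′)
      ≡⟨ quantify-++ Ω c (b ▹ τ) d (shift-cast _) x′ ⟩
    quantify Ω (b ▹ τ) c (quantify Ω ((b ▹ τ) ++ c) d x′)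
      ≡⟨ cong (quantify Ω (b ▹ τ) c) (subst-quantify Ω (sym (++-assoc b [ τ ] c)) d x) ⟨
    quantify Ω (b ▹ τ) c (subst Fm (sym (++-assoc b [ τ ] c)) (quantify Ω (b ++ τ ∷ c) d x)) ∎)
    where
    open ≡-Reasoning
    x′ : Fm (((b ▹ τ) ++ c) ++ d)
    x′ = subst Fm (cong (_++ d) (sym (++-assoc b [ τ ] c))) x
    S′ : Subst ((b ▹ τ) ++ (c ++ d)) (((b ▹ τ) ++ c) ++ d)
    S′ = ren (∈-cast (++-assoc (b ▹ τ) c d))
    reassociate : subst Fm (sym (++-assoc b [ τ ] (c ++ d))) (substFm S x) ≡ substFm S′ x′
    reassociate = trans (subst-Fm≡ren _ _) (trans (substFm-⊙ _ _ x)
      (trans (substFm-shift (shift-⊙ (shift-cast _) oS) (shift-⊙ (shift-cast _) (shift-cast _)) x)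
      (sym (trans (cong (substFm S′) (subst-Fm≡ren _ x)) (substFm-⊙ _ _ x)))))

  liftCtx : ∀ {b b'} c → Subst b b' → Subst (b ++ c) (b' ++ c)
  liftCtx {b} c f = (wkS ⊙ f) ++ᴬ ren (∈-++⁺ʳ b)

  lookup-liftCtx-∈-++⁺ˡ : ∀ {b b'} c (f : Subst b b') {σ} (j : σ ∈ b') →
                          All.lookup (liftCtx c f) (∈-++⁺ˡ j) ≡ substTm wkS (All.lookup f j)
  lookup-liftCtx-∈-++⁺ˡ {b} c f j = trans (lookup-++ᴬˡ (wkS ⊙ f) (ren (∈-++⁺ʳ b)) j) (lookup-⊙ wkS f j)

  lookup-liftCtx-∈-++⁺ʳ : ∀ {b b'} c (f : Subst b b') {σ} (k : σ ∈ c) →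
                          All.lookup (liftCtx c f) (∈-++⁺ʳ b' k) ≡ var (∈-++⁺ʳ b k)
  lookup-liftCtx-∈-++⁺ʳ {b} c f k = trans (lookup-++ᴬʳ (wkS ⊙ f) _ k) (lookup-ren (∈-++⁺ʳ b) k)

  length-▹ : ∀ (b : Ctx) τ → length (b ▹ τ) ≡ suc (length b)
  length-▹ b τ = trans (length-++ b) (+-comm (length b) 1)

  position-∈-cast-∈-++⁺ʳ : ∀ b {τ c σ} (k : σ ∈ c) →
    position (∈-cast (sym (++-assoc b [ τ ] c)) (∈-++⁺ʳ b (there k))) ≡ position (∈-++⁺ʳ (b ▹ τ) k)
  position-∈-cast-∈-++⁺ʳ b {τ} k =
    trans (position-∈-cast _ _) (trans (position-∈-++⁺ʳ b (there k)) (trans (+-suc (length b) (position k))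
      (sym (trans (position-∈-++⁺ʳ (b ▹ τ) k) (cong (_+ position k) (length-▹ b τ))))))

  position-∈-++⁺ʳ-here : ∀ b {τ c} → position (∈-++⁺ʳ b {τ ∷ c} (here refl)) ≡ position (∈-++⁺ˡ {ys = c} (∈-++⁺ʳ b {[ τ ]} (here refl)))
  position-∈-++⁺ʳ-here b {τ} {c} = trans (position-∈-++⁺ʳ b (here refl))
    (sym (trans (position-∈-++⁺ˡ {A = Sort} {ys = c} (∈-++⁺ʳ b {[ τ ]} (here refl))) (position-∈-++⁺ʳ b (here refl))))

  liftCtx-[] : ∀ {b b'} (f : Subst b b') →
               f ⊙ ren (∈-cast (++-identityʳ b')) ≡ ren (∈-cast (++-identityʳ b)) ⊙ liftCtx [] f
  liftCtx-[] {b} {b'} f = All-ext _ _ pointwise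
    where
    cast-b : Subst b (b ++ [])
    cast-b = ren (∈-cast (++-identityʳ b))
    wk : Subst (b ++ []) b
    wk = wkS
    pointwise : ∀ {σ} (i : σ ∈ b' ++ []) → _
    pointwise i with split b' i
    ... | inl j = begin
      All.lookup (f ⊙ ren (∈-cast (++-identityʳ b'))) (∈-++⁺ˡ j)
        ≡⟨ lookup-⊙-ren f _ (∈-++⁺ˡ j) ⟩
      All.lookup f (∈-cast (++-identityʳ b') (∈-++⁺ˡ j))
        ≡⟨ cong (All.lookup f) (position-injective _ _ (trans (position-∈-cast _ _) (position-∈-++⁺ˡ j))) ⟩
      All.lookup f j
        ≡⟨ substTm-id (All.lookup f j) ⟨
      substTm idS (All.lookup f j)
        ≡⟨ cong (λ u → substTm u (All.lookup f j)) (shift0-unique shift-idS (shift-⊙ (shift-cast _) shift-wkS)) ⟩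
      substTm (cast-b ⊙ wk) (All.lookup f j)
        ≡⟨ substTm-⊙ cast-b wk (All.lookup f j) ⟨
      substTm cast-b (substTm wk (All.lookup f j))
        ≡⟨ cong (substTm cast-b) (lookup-liftCtx-∈-++⁺ˡ [] f j) ⟨
      substTm cast-b (All.lookup (liftCtx [] f) (∈-++⁺ˡ j))
        ≡⟨ lookup-⊙ cast-b (liftCtx [] f) (∈-++⁺ˡ j) ⟨
      All.lookup (cast-b ⊙ liftCtx [] f) (∈-++⁺ˡ j) ∎
      where open ≡-Reasoning
    ... | inr ()

  module _ {b b'} (τ : Sort) (c : Ctx) (f : Subst b b') where
    private
      cast-b : Subst ((b ▹ τ) ++ c) (b ++ τ ∷ c)
      cast-b = ren (∈-cast (sym (++-assoc b [ τ ] c)))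
      cast-b′ : Ren (b' ++ τ ∷ c) ((b' ▹ τ) ++ c)
      cast-b′ = ∈-cast (sym (++-assoc b' [ τ ] c))
      wk₁ : Subst (b ▹ τ) b
      wk₁ = wkS
      wk₂ : Subst ((b ▹ τ) ++ c) (b ▹ τ)
      wk₂ = wkS
      wk₃ : Subst (b ++ τ ∷ c) b
      wk₃ = wkS
      g : Subst ((b ▹ τ) ++ c) ((b' ▹ τ) ++ c)
      g = liftCtx c (lift f τ)
      last : τ ∈ b ▹ τ
      last = ∈-++⁺ʳ b (here refl)
      last′ : τ ∈ b' ▹ τ
      last′ = ∈-++⁺ʳ b' (here refl)
      mid : τ ∈ b ++ τ ∷ c
      mid = ∈-++⁺ʳ b (here refl)
      mid′ : τ ∈ b' ++ τ ∷ c
      mid′ = ∈-++⁺ʳ b' (here refl)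
      rhs : ∀ {σ} (i : σ ∈ b' ++ τ ∷ c) → All.lookup (cast-b ⊙ liftCtx (τ ∷ c) f) i ≡ substTm cast-b (All.lookup (liftCtx (τ ∷ c) f) i)
      rhs = lookup-⊙ cast-b (liftCtx (τ ∷ c) f)
    open ≡-Reasoning

    liftCtx-∷-on-prefix : ∀ {σ} (j : σ ∈ b') →
                          All.lookup (g ⊙ ren cast-b′) (∈-++⁺ˡ j) ≡ All.lookup (cast-b ⊙ liftCtx (τ ∷ c) f) (∈-++⁺ˡ j)
    liftCtx-∷-on-prefix j = begin
      All.lookup (g ⊙ ren cast-b′) (∈-++⁺ˡ j)
        ≡⟨ lookup-⊙-ren g cast-b′ (∈-++⁺ˡ j) ⟩
      All.lookup g (cast-b′ (∈-++⁺ˡ j))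
        ≡⟨ cong (All.lookup g) (position-injective _ (∈-++⁺ˡ (∈-++⁺ˡ j))
             (trans (position-∈-cast _ _) (trans (position-∈-++⁺ˡ j) (sym (trans (position-∈-++⁺ˡ _) (position-∈-++⁺ˡ j)))))) ⟩
      All.lookup g (∈-++⁺ˡ (∈-++⁺ˡ j))
        ≡⟨ lookup-liftCtx-∈-++⁺ˡ c (lift f τ) (∈-++⁺ˡ j) ⟩
      substTm wk₂ (All.lookup (lift f τ) (∈-++⁺ˡ j))
        ≡⟨ cong (substTm wk₂) (lookup-lift-∈-++⁺ˡ f τ j) ⟩
      substTm wk₂ (substTm wk₁ (All.lookup f j))
        ≡⟨ substTm-⊙ wk₂ wk₁ (All.lookup f j) ⟩
      substTm (wk₂ ⊙ wk₁) (All.lookup f j)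
        ≡⟨ cong (λ u → substTm u (All.lookup f j)) (shift0-unique (shift-⊙ shift-wkS shift-wkS) (shift-⊙ (shift-cast _) shift-wkS)) ⟩
      substTm (cast-b ⊙ wk₃) (All.lookup f j)
        ≡⟨ substTm-⊙ cast-b wk₃ (All.lookup f j) ⟨
      substTm cast-b (substTm wk₃ (All.lookup f j))
        ≡⟨ cong (substTm cast-b) (lookup-liftCtx-∈-++⁺ˡ (τ ∷ c) f j) ⟨
      substTm cast-b (All.lookup (liftCtx (τ ∷ c) f) (∈-++⁺ˡ j))
        ≡⟨ rhs (∈-++⁺ˡ j) ⟨
      All.lookup (cast-b ⊙ liftCtx (τ ∷ c) f) (∈-++⁺ˡ j) ∎

    liftCtx-∷-on-τ : All.lookup (g ⊙ ren cast-b′) mid′ ≡ All.lookup (cast-b ⊙ liftCtx (τ ∷ c) f) mid′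
    liftCtx-∷-on-τ = begin
      All.lookup (g ⊙ ren cast-b′) mid′
        ≡⟨ lookup-⊙-ren g cast-b′ _ ⟩
      All.lookup g (cast-b′ mid′)
        ≡⟨ cong (All.lookup g) (position-injective _ (∈-++⁺ˡ {ys = c} last′)
             (trans (position-∈-cast _ _) (position-∈-++⁺ʳ-here b'))) ⟩
      All.lookup g (∈-++⁺ˡ {ys = c} last′)
        ≡⟨ lookup-liftCtx-∈-++⁺ˡ c (lift f τ) _ ⟩
      substTm wk₂ (All.lookup (lift f τ) last′)
        ≡⟨ trans (cong (substTm wk₂) (lookup-lift-last f τ)) (lookup-ren ∈-++⁺ˡ last) ⟩
      var (∈-++⁺ˡ {ys = c} last)
        ≡⟨ var-≡ _ _ (sym (trans (position-∈-cast _ _) (position-∈-++⁺ʳ-here b))) ⟩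
      var (∈-cast (sym (++-assoc b [ τ ] c)) mid)
        ≡⟨ lookup-ren (∈-cast (sym (++-assoc b [ τ ] c))) _ ⟨
      substTm cast-b (var mid)
        ≡⟨ cong (substTm cast-b) (lookup-liftCtx-∈-++⁺ʳ (τ ∷ c) f (here refl)) ⟨
      substTm cast-b (All.lookup (liftCtx (τ ∷ c) f) mid′)
        ≡⟨ rhs _ ⟨
      All.lookup (cast-b ⊙ liftCtx (τ ∷ c) f) mid′ ∎

    liftCtx-∷-on-suffix : ∀ {σ} (k : σ ∈ c) →
                          All.lookup (g ⊙ ren cast-b′) (∈-++⁺ʳ b' (there k)) ≡ All.lookup (cast-b ⊙ liftCtx (τ ∷ c) f) (∈-++⁺ʳ b' (there k))
    liftCtx-∷-on-suffix k = begin
      All.lookup (g ⊙ ren cast-b′) (∈-++⁺ʳ b' (there k))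
        ≡⟨ lookup-⊙-ren g cast-b′ _ ⟩
      All.lookup g (cast-b′ (∈-++⁺ʳ b' (there k)))
        ≡⟨ cong (All.lookup g) (position-injective _ (∈-++⁺ʳ (b' ▹ τ) k) (position-∈-cast-∈-++⁺ʳ b' k)) ⟩
      All.lookup g (∈-++⁺ʳ (b' ▹ τ) k)
        ≡⟨ lookup-liftCtx-∈-++⁺ʳ c (lift f τ) k ⟩
      var (∈-++⁺ʳ (b ▹ τ) k)
        ≡⟨ var-≡ _ _ (sym (position-∈-cast-∈-++⁺ʳ b k)) ⟩
      var (∈-cast (sym (++-assoc b [ τ ] c)) (∈-++⁺ʳ b (there k)))
        ≡⟨ lookup-ren (∈-cast (sym (++-assoc b [ τ ] c))) _ ⟨
      substTm cast-b (var (∈-++⁺ʳ b (there k)))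
        ≡⟨ cong (substTm cast-b) (lookup-liftCtx-∈-++⁺ʳ (τ ∷ c) f (there k)) ⟨
      substTm cast-b (All.lookup (liftCtx (τ ∷ c) f) (∈-++⁺ʳ b' (there k)))
        ≡⟨ rhs _ ⟨
      All.lookup (cast-b ⊙ liftCtx (τ ∷ c) f) (∈-++⁺ʳ b' (there k)) ∎

    liftCtx-∷ : liftCtx c (lift f τ) ⊙ ren (∈-cast (sym (++-assoc b' [ τ ] c)))
                ≡ ren (∈-cast (sym (++-assoc b [ τ ] c))) ⊙ liftCtx (τ ∷ c) f
    liftCtx-∷ = All-ext _ _ pointwise
      where
      pointwise : ∀ {σ} (i : σ ∈ b' ++ τ ∷ c) → All.lookup (g ⊙ ren cast-b′) i ≡ All.lookup (cast-b ⊙ liftCtx (τ ∷ c) f) i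
      pointwise i with split b' i
      ... | inl j = liftCtx-∷-on-prefix j
      ... | inr (here refl) = liftCtx-∷-on-τ
      ... | inr (there k) = liftCtx-∷-on-suffix k

  substFm-cast-⊙ : ∀ {Δ Γ Γ'} (s : Subst Δ Γ') (p : Γ ≡ Γ') (x : Fm Γ) →
                   substFm s (subst Fm p x) ≡ substFm (s ⊙ ren (∈-cast p)) x
  substFm-cast-⊙ s p x = trans (cong (substFm s) (subst-Fm≡ren p x)) (substFm-⊙ _ _ x)

  substFm-quantify : ∀ Ω c {b b'} (f : Subst b b') (x : Fm (b' ++ c)) →
                     substFm f (quantify Ω b' c x) ≡ quantify Ω b c (substFm (liftCtx c f) x)
  substFm-quantify Ω [] {b} f x =
    trans (substFm-cast-⊙ f _ x) (trans (cong (λ u → substFm u x) (liftCtx-[] f))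
      (sym (trans (subst-Fm≡ren _ _) (substFm-⊙ _ _ x))))
  substFm-quantify Ω (τ ∷ c) {b} f x = cong (qnt Ω τ)
    (trans (substFm-quantify Ω c (lift f τ) _)
      (cong (quantify Ω (b ▹ τ) c) (trans (substFm-cast-⊙ _ _ x) (trans (cong (λ u → substFm u x) (liftCtx-∷ τ c f))
        (sym (trans (subst-Fm≡ren _ _) (substFm-⊙ _ _ x)))))))

  substFm-⨂ : ∀ {Δ Γ} (s : Subst Δ Γ) (Φ : List (Fm Γ)) → substFm s (⨂ Φ) ≡ ⨂ (substList s Φ)
  substFm-⨂ s [] = refl
  substFm-⨂ s (φ ∷ []) = refl
  substFm-⨂ s (φ ∷ ψ ∷ Φ) = cong (substFm s φ ⊗F_) (substFm-⨂ s (ψ ∷ Φ))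

  eqList-++ : ∀ Γ Δ₁ Δ₂ (r : Ren (Δ₁ ++ Δ₂) Γ) →
              eqList (Der T) Γ (Δ₁ ++ Δ₂) r ≡ eqList (Der T) Γ Δ₁ (λ i → r (∈-++⁺ˡ i)) ++ eqList (Der T) Γ Δ₂ (λ i → r (∈-++⁺ʳ Δ₁ i))
  eqList-++ Γ [] Δ₂ r = refl
  eqList-++ Γ (σ ∷ Δ₁) Δ₂ r = cong (_ ∷_) (eqList-++ Γ Δ₁ Δ₂ (λ i → r (there i)))

  doubled : ∀ {Γ Γ'} → Ren Γ Γ' → Subst (Γ' ++ Γ') (Γ ++ Γ)
  doubled {Γ' = Γ'} ρ = (wkS ⊙ ren ρ) ++ᴬ (ren (∈-++⁺ʳ Γ') ⊙ ren ρ)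

  substList-eqList : ∀ {Γ Γ'} (ρ : Ren Γ Γ') Δ (r : Ren Δ Γ) →
                     substList (doubled ρ) (eqList (Der T) Γ Δ r) ≡ eqList (Der T) Γ' Δ (λ i → ρ (r i))
  substList-eqList ρ [] r = refl
  substList-eqList {Γ} {Γ'} ρ (σ ∷ Δ) r = cong₂ _∷_
    (cong₂ (eq σ) (trans (lookup-++ᴬˡ (wkS ⊙ ren ρ) _ x) (trans (lookup-⊙-ren wkS ρ x) (lookup-ren ∈-++⁺ˡ (ρ x))))
                  (trans (lookup-++ᴬʳ (wkS ⊙ ren ρ) _ x) (trans (lookup-⊙-ren right ρ x) (lookup-ren (∈-++⁺ʳ Γ') (ρ x)))))
    (substList-eqList ρ Δ (λ i → r (there i)))
    where
    x = r (here refl)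
    right : Subst (Γ' ++ Γ') Γ'
    right = ren (∈-++⁺ʳ Γ')

  EqFm-++ : ∀ c₁ c₂ → EqFm (Der T) (c₁ ++ c₂) ≅
            (substFm (doubled {c₁} {c₁ ++ c₂} ∈-++⁺ˡ) (EqFm (Der T) c₁) ⊗F substFm (doubled {c₂} {c₁ ++ c₂} (∈-++⁺ʳ c₁)) (EqFm (Der T) c₂))
  EqFm-++ c₁ c₂ =
    ≅-trans (≅-reflexive (cong ⨂ (eqList-++ (c₁ ++ c₂) c₁ c₂ (λ i → i))))
    (≅-trans (⨂-++ (eqList (Der T) (c₁ ++ c₂) c₁ ∈-++⁺ˡ) (eqList (Der T) (c₁ ++ c₂) c₂ (∈-++⁺ʳ c₁)))
    (≅-reflexive (sym (cong₂ _⊗F_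
      (trans (substFm-⨂ (doubled {c₁} {c₁ ++ c₂} ∈-++⁺ˡ) (eqList (Der T) c₁ c₁ (λ i → i))) (cong ⨂ (substList-eqList ∈-++⁺ˡ c₁ (λ i → i))))
      (trans (substFm-⨂ (doubled {c₂} {c₁ ++ c₂} (∈-++⁺ʳ c₁)) (eqList (Der T) c₂ c₂ (λ i → i))) (cong ⨂ (substList-eqList (∈-++⁺ʳ c₁) c₂ (λ i → i))))))))

  ++ᴬ-unique : ∀ {a b c} (h : Subst c (a ++ b)) (f : Subst c a) (g : Subst c b) →
               HomEq (h ⊙ wkS {a} {b}) f → HomEq (h ⊙ ren (∈-++⁺ʳ a)) g → HomEq h (f ++ᴬ g)
  ++ᴬ-unique {a} {b} h f g h₁≡f h₂≡g =
    homEq-trans (homEq-reflexive (All-ext _ _ pointwise)) (homEq-++ᴬ h₁≡f h₂≡g)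
    where
    pointwise : ∀ {σ} (i : σ ∈ a ++ b) → All.lookup h i ≡ All.lookup ((h ⊙ wkS {a} {b}) ++ᴬ (h ⊙ ren (∈-++⁺ʳ a))) i
    pointwise i with split a i
    ... | inl j = sym (trans (lookup-++ᴬˡ (h ⊙ wkS {a} {b}) _ j) (lookup-⊙-ren h ∈-++⁺ˡ j))
    ... | inr j = sym (trans (lookup-++ᴬʳ (h ⊙ wkS {a} {b}) _ j) (lookup-⊙-ren h (∈-++⁺ʳ a) j))

  !-unique : ∀ {a} (f : Subst a []) → HomEq f []
  !-unique [] = tt

  reassociate : ∀ b c d → Subst (b ++ (c ++ d)) ((b ++ c) ++ d)
  reassociate b c d = (wkS {b} {c ++ d} ++ᴬ (ren (∈-++⁺ʳ b) ⊙ wkS {c} {d})) ++ᴬ (ren (∈-++⁺ʳ b) ⊙ ren (∈-++⁺ʳ c))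

  shift-reassociate : ∀ b c d → IsShift 0 (reassociate b c d)
  shift-reassociate b c d =
    shift-++ᴬ {Γ = b ++ c} (shift-++ᴬ {Γ = b} shift-wkS (shift-offset (+-identityʳ (length b)) (shift-⊙ (shift-∈-++⁺ʳ b) shift-wkS)))
              (shift-offset (sym (length-++ b)) (shift-⊙ (shift-∈-++⁺ʳ b) (shift-∈-++⁺ʳ c)))

  classLaws : FALaws ClassData
  classLaws = record
    { ≈-equiv = record { refl = homEq-refl _ ; sym = homEq-sym ; trans = homEq-trans }
    ; ∘-resp = homEq-⊙
    ; idˡ = λ f → homEq-reflexive (⊙-identityʳ f)
    ; idʳ = λ f → homEq-reflexive (⊙-identityˡ f)
    ; assoc = λ f g h → homEq-reflexive (sym (⊙-assoc h g f))
    ; !-unique = !-unique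
    ; π₁-β = λ f g → homEq-reflexive (All-ext _ _ λ i → trans (lookup-⊙-ren (f ++ᴬ g) ∈-++⁺ˡ i) (lookup-++ᴬˡ f g i))
    ; π₂-β = λ {a} f g → homEq-reflexive (All-ext _ _ λ i → trans (lookup-⊙-ren (f ++ᴬ g) (∈-++⁺ʳ a) i) (lookup-++ᴬʳ f g i))
    ; ⟨⟩-unique = ++ᴬ-unique
    ; P-poset = record
        { isPreorder = record
            { isEquivalence = record { refl = ≅-refl _ ; sym = ≅-sym ; trans = ≅-trans }
            ; reflexive = proj₁
            ; trans = cut }
        ; antisym = _,_ }
    ; Pmap-mono = λ f → subst-seq f f (homEq-refl f)
    ; Pmap-cong = λ f (x⊢y , y⊢x) → subst-seq f f (homEq-refl f) x⊢y , subst-seq f f (homEq-refl f) y⊢x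
    ; Pmap-resp = λ {_} {_} {f} {g} f≡g x → subst-seq f g f≡g (ax x) , subst-seq g f (homEq-sym f≡g) (ax x)
    ; Pmap-id = λ x → ≅-reflexive (substFm-id x)
    ; Pmap-∘ = λ g f x → ≅-reflexive (sym (substFm-⊙ f g x))
    ; conn-cong = λ o pw → ◇-cong o _ _ (λ i → proj₁ (Pointwise.lookup pw i)) (λ i → proj₂ (Pointwise.lookup pw i)) ,
                           ◇-cong o _ _ (λ i → proj₂ (Pointwise.lookup pw i)) (λ i → proj₁ (Pointwise.lookup pw i))
    ; Pmap-hom = λ f o xs → ≅-reflexive (cong (con o) (substFms≡map f xs))
    ; quant-cong = quantify-cong
    ; quant-nat = λ Ω c f x → ≅-reflexive (sym (substFm-quantify Ω c f x))
    ; ⊗-assoc = ⊗F-assoc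
    ; ⊗-idˡ = ⊗F-identityˡ
    ; ⊗-idʳ = ⊗F-identityʳ
    ; quant-𝟙 = λ Ω b x → ≅-reflexive (trans (subst-Fm≡ren _ _)
                  (trans (substFm-⊙ _ _ x) (trans (substFm-shift (shift-⊙ (shift-cast _) shift-wkS) shift-idS x) (substFm-id x))))
    ; quant-× = λ Ω b c d x → ≅-reflexive (quantify-++ Ω c b d (shift-reassociate b c d) x)
    ; Eq-𝟙 = ≅-refl _
    ; Eq-× = EqFm-++
    }

module Soundness (L : Language) (Sg : Signature) (D : FA.FAData L) (laws : FA.FALaws L D)
                 (S : Semantics.Structure L Sg D) where
  open Language L
  open Syntax L Sg
  open SubstitutionCalculus L Sg
  open FA.FAData D hiding (_×_)
  open FA.FALaws laws
  open Semantics L Sg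
  open Interp D S
  open Structure S using (sortI)

  private
    module ≈ {a b} = IsEquivalence (≈-equiv {a} {b})
    module ≤ {c} = IsPartialOrder (P-poset {c})

    homSetoid : Obj → Obj → Setoid _ _
    homSetoid a b = record { isEquivalence = ≈-equiv {a} {b} }

  ≡⇒≈ : ∀ {a b} {f g : Hom a b} → f ≡ g → f ≈ g
  ≡⇒≈ refl = ≈.refl

  ≡⇒≈P : ∀ {c} {x y : PC c} → x ≡ y → x ≈P y
  ≡⇒≈P refl = ≤.Eq.refl

  ≤-respˡʳ-≈P : ∀ {c} {x x' y y' : PC c} → x ≈P x' → x' ≤P y' → y' ≈P y → x ≤P y
  ≤-respˡʳ-≈P p q r = ≤.trans (≤.reflexive p) (≤.trans q (≤.reflexive r))

  ∘-respˡ : ∀ {a b c} {f f' : Hom b c} {g : Hom a b} → f ≈ f' → (f ∘ g) ≈ (f' ∘ g)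
  ∘-respˡ p = ∘-resp p ≈.refl

  ∘-respʳ : ∀ {a b c} {f : Hom b c} {g g' : Hom a b} → g ≈ g' → (f ∘ g) ≈ (f ∘ g')
  ∘-respʳ = ∘-resp ≈.refl

  ⟨⟩-cong : ∀ {a b c} {f f' : Hom c a} {g g' : Hom c b} → f ≈ f' → g ≈ g' → ⟨ f , g ⟩ ≈ ⟨ f' , g' ⟩
  ⟨⟩-cong p q = ⟨⟩-unique _ _ _ (≈.trans (π₁-β _ _) p) (≈.trans (π₂-β _ _) q)

  ⟨⟩-∘ : ∀ {a b c d} (f : Hom c a) (g : Hom c b) (h : Hom d c) → (⟨ f , g ⟩ ∘ h) ≈ ⟨ f ∘ h , g ∘ h ⟩
  ⟨⟩-∘ f g h = ⟨⟩-unique _ _ _ (≈.trans (≈.sym (assoc _ _ _)) (∘-respˡ (π₁-β f g)))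
                                 (≈.trans (≈.sym (assoc _ _ _)) (∘-respˡ (π₂-β f g)))

  ⟦_⟧s : ∀ {Δ Γ} → Subst Δ Γ → Hom ⟦ Δ ⟧c ⟦ Γ ⟧c
  ⟦ [] ⟧s = !
  ⟦ M ∷ [] ⟧s = ⟦ M ⟧t
  ⟦ M ∷ N ∷ s ⟧s = ⟨ ⟦ M ⟧t , ⟦ N ∷ s ⟧s ⟩

  proj-∘-⟦⟧s : ∀ {Δ Γ} (s : Subst Δ Γ) {σ} (i : σ ∈ Γ) → (proj i ∘ ⟦ s ⟧s) ≈ ⟦ All.lookup s i ⟧t
  proj-∘-⟦⟧s (M ∷ []) (here refl) = idˡ _
  proj-∘-⟦⟧s (M ∷ N ∷ s) (here refl) = π₁-β _ _
  proj-∘-⟦⟧s (M ∷ N ∷ s) (there i) =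
    ≈.trans (assoc _ _ _) (≈.trans (∘-respʳ (π₂-β _ _)) (proj-∘-⟦⟧s (N ∷ s) i))

  proj-jointly-monic : ∀ Γ {X} (f g : Hom X ⟦ Γ ⟧c) → (∀ {σ} (i : σ ∈ Γ) → (proj i ∘ f) ≈ (proj i ∘ g)) → f ≈ g
  proj-jointly-monic [] f g _ = ≈.trans (!-unique f) (≈.sym (!-unique g))
  proj-jointly-monic (σ ∷ []) f g h = ≈.trans (≈.sym (idˡ f)) (≈.trans (h (here refl)) (idˡ g))
  proj-jointly-monic (σ ∷ τ ∷ Γ) f g h =
    ≈.trans (⟨⟩-unique f _ _ ≈.refl ≈.refl)
      (≈.sym (⟨⟩-unique g (π₁ ∘ f) (π₂ ∘ f) (≈.sym (h (here refl)))
        (proj-jointly-monic (τ ∷ Γ) _ _ λ i → ≈.trans (≈.sym (assoc _ _ _)) (≈.trans (≈.sym (h (there i))) (assoc _ _ _)))))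

  mutual
    ⟦substTm⟧ : ∀ {Δ Γ σ} (s : Subst Δ Γ) (M : Tm Γ σ) → ⟦ substTm s M ⟧t ≈ (⟦ M ⟧t ∘ ⟦ s ⟧s)
    ⟦substTm⟧ s (var i) = ≈.sym (proj-∘-⟦⟧s s i)
    ⟦substTm⟧ s (app f Ms) = ≈.trans (∘-respʳ (⟦substTms⟧ s Ms)) (≈.sym (assoc _ _ _))

    ⟦substTms⟧ : ∀ {Δ Γ σs} (s : Subst Δ Γ) (Ms : Tms Γ σs) → ⟦ substTms s Ms ⟧ts ≈ (⟦ Ms ⟧ts ∘ ⟦ s ⟧s)
    ⟦substTms⟧ s [] = ≈.sym (!-unique _)
    ⟦substTms⟧ s (M ∷ []) = ⟦substTm⟧ s M
    ⟦substTms⟧ s (M ∷ N ∷ Ms) = ≈.trans (⟨⟩-cong (⟦substTm⟧ s M) (⟦substTms⟧ s (N ∷ Ms))) (≈.sym (⟨⟩-∘ _ _ _))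

  proj-∈-++⁺ˡ-∘-ext : ∀ Γ σ {τ} (j : τ ∈ Γ) → (proj (∈-++⁺ˡ {ys = [ σ ]} j) ∘ ext Γ σ) ≈ (proj j ∘ π₁)
  proj-∈-++⁺ˡ-∘-ext (τ ∷ []) σ (here refl) = ≈.trans (idʳ _) (≈.sym (idˡ _))
  proj-∈-++⁺ˡ-∘-ext (τ ∷ ρ ∷ Γ) σ (here refl) = π₁-β _ _
  proj-∈-++⁺ˡ-∘-ext (τ ∷ ρ ∷ Γ) σ (there j) = begin
    (proj (∈-++⁺ˡ j) ∘ π₂) ∘ ext (τ ∷ ρ ∷ Γ) σ            ≈⟨ assoc _ _ _ ⟩
    proj (∈-++⁺ˡ j) ∘ (π₂ ∘ ext (τ ∷ ρ ∷ Γ) σ)            ≈⟨ ∘-respʳ (π₂-β _ _) ⟩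
    proj (∈-++⁺ˡ j) ∘ (ext (ρ ∷ Γ) σ ∘ ⟨ π₂ ∘ π₁ , π₂ ⟩)  ≈⟨ assoc _ _ _ ⟨
    (proj (∈-++⁺ˡ j) ∘ ext (ρ ∷ Γ) σ) ∘ ⟨ π₂ ∘ π₁ , π₂ ⟩  ≈⟨ ∘-respˡ (proj-∈-++⁺ˡ-∘-ext (ρ ∷ Γ) σ j) ⟩
    (proj j ∘ π₁) ∘ ⟨ π₂ ∘ π₁ , π₂ ⟩                      ≈⟨ assoc _ _ _ ⟩
    proj j ∘ (π₁ ∘ ⟨ π₂ ∘ π₁ , π₂ ⟩)                      ≈⟨ ∘-respʳ (π₁-β _ _) ⟩
    proj j ∘ (π₂ ∘ π₁)                                    ≈⟨ assoc _ _ _ ⟨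
    (proj j ∘ π₂) ∘ π₁                                    ∎
    where open SetoidReasoning (homSetoid _ _)

  proj-last-∘-ext : ∀ Γ σ → (proj (∈-++⁺ʳ Γ {[ σ ]} (here refl)) ∘ ext Γ σ) ≈ π₂
  proj-last-∘-ext [] σ = idˡ _
  proj-last-∘-ext (τ ∷ []) σ = ≈.trans (idʳ _) (idˡ _)
  proj-last-∘-ext (τ ∷ ρ ∷ Γ) σ =
    ≈.trans (assoc _ _ _) (≈.trans (∘-respʳ (π₂-β _ _)) (≈.trans (≈.sym (assoc _ _ _))
      (≈.trans (∘-respˡ (proj-last-∘-ext (ρ ∷ Γ) σ)) (π₂-β _ _))))

  ⟦wkS⟧-∘-ext : ∀ Δ σ → (⟦ wkS {Δ} {[ σ ]} ⟧s ∘ ext Δ σ) ≈ π₁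
  ⟦wkS⟧-∘-ext Δ σ = proj-jointly-monic Δ _ _ λ k →
    ≈.trans (≈.sym (assoc _ _ _)) (≈.trans (∘-respˡ (proj-∘-⟦⟧s (wkS {Δ} {[ σ ]}) k))
      (≈.trans (∘-respˡ (≡⇒≈ (cong ⟦_⟧t (lookup-ren ∈-++⁺ˡ k)))) (proj-∈-++⁺ˡ-∘-ext Δ σ k)))

  ⟦lift⟧-∘-ext : ∀ {Δ Γ} (s : Subst Δ Γ) σ → (⟦ lift s σ ⟧s ∘ ext Δ σ) ≈ (ext Γ σ ∘ ⟨ ⟦ s ⟧s ∘ π₁ , π₂ ⟩)
  ⟦lift⟧-∘-ext {Δ} {Γ} s σ = proj-jointly-monic (Γ ▹ σ) _ _ pointwise
    where
    wk : Subst (Δ ▹ σ) Δ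
    wk = wkS
    s×σ = ⟨ ⟦ s ⟧s ∘ π₁ {⟦ Δ ⟧c} {sortI σ} , π₂ ⟩
    pointwise : ∀ {τ} (i : τ ∈ Γ ▹ σ) → (proj i ∘ (⟦ lift s σ ⟧s ∘ ext Δ σ)) ≈ (proj i ∘ (ext Γ σ ∘ s×σ))
    pointwise i with split Γ i
    ... | inl j = begin
      proj (∈-++⁺ˡ j) ∘ (⟦ lift s σ ⟧s ∘ ext Δ σ)         ≈⟨ assoc _ _ _ ⟨
      (proj (∈-++⁺ˡ j) ∘ ⟦ lift s σ ⟧s) ∘ ext Δ σ         ≈⟨ ∘-respˡ (proj-∘-⟦⟧s (lift s σ) (∈-++⁺ˡ j)) ⟩
      ⟦ All.lookup (lift s σ) (∈-++⁺ˡ j) ⟧t ∘ ext Δ σ    ≈⟨ ∘-respˡ (≡⇒≈ (cong ⟦_⟧t (lookup-lift-∈-++⁺ˡ s σ j))) ⟩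
      ⟦ substTm wk (All.lookup s j) ⟧t ∘ ext Δ σ         ≈⟨ ∘-respˡ (⟦substTm⟧ wk (All.lookup s j)) ⟩
      (⟦ All.lookup s j ⟧t ∘ ⟦ wk ⟧s) ∘ ext Δ σ          ≈⟨ assoc _ _ _ ⟩
      ⟦ All.lookup s j ⟧t ∘ (⟦ wk ⟧s ∘ ext Δ σ)          ≈⟨ ∘-respʳ (⟦wkS⟧-∘-ext Δ σ) ⟩
      ⟦ All.lookup s j ⟧t ∘ π₁                           ≈⟨ ∘-respˡ (proj-∘-⟦⟧s s j) ⟨
      (proj j ∘ ⟦ s ⟧s) ∘ π₁                             ≈⟨ assoc _ _ _ ⟩
      proj j ∘ (⟦ s ⟧s ∘ π₁)                             ≈⟨ ∘-respʳ (π₁-β _ _) ⟨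
      proj j ∘ (π₁ ∘ s×σ)                                ≈⟨ assoc _ _ _ ⟨
      (proj j ∘ π₁) ∘ s×σ                                ≈⟨ ∘-respˡ (proj-∈-++⁺ˡ-∘-ext Γ σ j) ⟨
      (proj (∈-++⁺ˡ j) ∘ ext Γ σ) ∘ s×σ                  ≈⟨ assoc _ _ _ ⟩
      proj (∈-++⁺ˡ j) ∘ (ext Γ σ ∘ s×σ)                  ∎
      where open SetoidReasoning (homSetoid _ _)
    ... | inr (here refl) = begin
      proj last ∘ (⟦ lift s σ ⟧s ∘ ext Δ σ)               ≈⟨ assoc _ _ _ ⟨
      (proj last ∘ ⟦ lift s σ ⟧s) ∘ ext Δ σ               ≈⟨ ∘-respˡ (proj-∘-⟦⟧s (lift s σ) last) ⟩
      ⟦ All.lookup (lift s σ) last ⟧t ∘ ext Δ σ          ≈⟨ ∘-respˡ (≡⇒≈ (cong ⟦_⟧t (lookup-lift-last s σ))) ⟩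
      proj (∈-++⁺ʳ Δ (here refl)) ∘ ext Δ σ              ≈⟨ proj-last-∘-ext Δ σ ⟩
      π₂                                                 ≈⟨ π₂-β _ _ ⟨
      π₂ ∘ s×σ                                           ≈⟨ ∘-respˡ (proj-last-∘-ext Γ σ) ⟨
      (proj last ∘ ext Γ σ) ∘ s×σ                        ≈⟨ assoc _ _ _ ⟩
      proj last ∘ (ext Γ σ ∘ s×σ)                        ∎
      where
      open SetoidReasoning (homSetoid _ _)
      last : σ ∈ Γ ▹ σ
      last = ∈-++⁺ʳ Γ (here refl)

  mutual
    ⟦substFm⟧ : ∀ {Δ Γ} (s : Subst Δ Γ) (φ : Fm Γ) → ⟦ substFm s φ ⟧f ≈P Pmap ⟦ s ⟧s ⟦ φ ⟧f
    ⟦substFm⟧ s (rel R Ms) = ≤.Eq.trans (Pmap-resp (⟦substTms⟧ s Ms) _) (Pmap-∘ _ _ _)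
    ⟦substFm⟧ s (eq σ M N) =
      ≤.Eq.trans (Pmap-resp (≈.trans (⟨⟩-cong (⟦substTm⟧ s M) (⟦substTm⟧ s N)) (≈.sym (⟨⟩-∘ _ _ _))) _) (Pmap-∘ _ _ _)
    ⟦substFm⟧ s (con o φs) = ≤.Eq.trans (conn-cong o (⟦substFms⟧ s φs)) (≤.Eq.sym (Pmap-hom _ o _))
    ⟦substFm⟧ {Δ} {Γ} s (qnt Ω σ φ) =
      ≤.Eq.trans (quant-cong Ω _ _ (Pmap-cong (ext Δ σ) (⟦substFm⟧ (lift s σ) φ)))
      (≤.Eq.trans (quant-cong Ω _ _ (≤.Eq.sym (Pmap-∘ _ _ _)))
      (≤.Eq.trans (quant-cong Ω _ _ (Pmap-resp (⟦lift⟧-∘-ext s σ) _))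
      (≤.Eq.trans (quant-cong Ω _ _ (Pmap-∘ _ _ _))
      (quant-nat Ω (sortI σ) ⟦ s ⟧s _))))

    ⟦substFms⟧ : ∀ {Δ Γ n} (s : Subst Δ Γ) (φs : Vec (Fm Γ) n) →
                 Pointwise _≈P_ ⟦ substFms s φs ⟧fs (Vec.map (Pmap ⟦ s ⟧s) ⟦ φs ⟧fs)
    ⟦substFms⟧ s [] = []
    ⟦substFms⟧ s (φ ∷ φs) = ⟦substFm⟧ s φ ∷ ⟦substFms⟧ s φs

  ⊗-cong : ∀ {c} {x x' y y' : PC c} → x ≈P x' → y ≈P y' → (x ⊗ y) ≈P (x' ⊗ y')
  ⊗-cong p q = conn-cong ⊗C (p ∷ q ∷ [])

  tensor-++ : ∀ {c} (xs ys : List (PC c)) → tensor (xs ++ ys) ≈P (tensor xs ⊗ tensor ys)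
  tensor-++ [] ys = ≤.Eq.sym (⊗-idˡ _)
  tensor-++ (x ∷ []) [] = ≤.Eq.sym (⊗-idʳ _)
  tensor-++ (x ∷ []) (y ∷ ys) = ≤.Eq.refl
  tensor-++ (x ∷ x′ ∷ xs) ys = ≤.Eq.trans (⊗-cong ≤.Eq.refl (tensor-++ (x′ ∷ xs) ys)) (≤.Eq.sym (⊗-assoc _ _ _))

  tensor-cong-middle : ∀ {c} (xs : List (PC c)) {ys ys'} zs → tensor ys ≈P tensor ys' →
                       tensor (xs ++ ys ++ zs) ≈P tensor (xs ++ ys' ++ zs)
  tensor-cong-middle xs {ys} {ys'} zs p =
    ≤.Eq.trans (tensor-++ xs (ys ++ zs))
    (≤.Eq.trans (⊗-cong ≤.Eq.refl (≤.Eq.trans (tensor-++ ys zs) (≤.Eq.trans (⊗-cong p ≤.Eq.refl) (≤.Eq.sym (tensor-++ ys' zs)))))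
    (≤.Eq.sym (tensor-++ xs (ys' ++ zs))))

  ⟦_⟧hyps : ∀ {Γ} → List (Fm Γ) → PC ⟦ Γ ⟧c
  ⟦ Φ ⟧hyps = tensor (List.map ⟦_⟧f Φ)

  ⟦⟧hyps-cong-middle : ∀ {Γ} (Φ : List (Fm Γ)) {Ξ Ξ'} Ψ → ⟦ Ξ ⟧hyps ≈P ⟦ Ξ' ⟧hyps →
                       ⟦ Φ ++ Ξ ++ Ψ ⟧hyps ≈P ⟦ Φ ++ Ξ' ++ Ψ ⟧hyps
  ⟦⟧hyps-cong-middle Φ {Ξ} {Ξ'} Ψ p =
    ≤.Eq.trans (≡⇒≈P (cong tensor (trans (map-++ ⟦_⟧f Φ _) (cong (List.map ⟦_⟧f Φ ++_) (map-++ ⟦_⟧f Ξ Ψ)))))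
    (≤.Eq.trans (tensor-cong-middle (List.map ⟦_⟧f Φ) (List.map ⟦_⟧f Ψ) p)
    (≡⇒≈P (cong tensor (sym (trans (map-++ ⟦_⟧f Φ _) (cong (List.map ⟦_⟧f Φ ++_) (map-++ ⟦_⟧f Ξ' Ψ)))))))

  ⟦substList⟧ : ∀ {Δ Γ} (s : Subst Δ Γ) (Φ : List (Fm Γ)) →
                ⟦ List.map (substFm s) Φ ⟧hyps ≈P Pmap ⟦ s ⟧s ⟦ Φ ⟧hyps
  ⟦substList⟧ s [] = ≤.Eq.sym (Pmap-hom _ eC [])
  ⟦substList⟧ s (φ ∷ []) = ⟦substFm⟧ s φ
  ⟦substList⟧ s (φ ∷ ψ ∷ Φ) = ≤.Eq.trans (⊗-cong (⟦substFm⟧ s φ) (⟦substList⟧ s (ψ ∷ Φ))) (≤.Eq.sym (Pmap-hom _ ⊗C _))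

  ⟦sub1⟧-cong : ∀ Γ {Γ' σ} (N N' : Tm (Γ ++ Γ') σ) → ⟦ N ⟧t ≈ ⟦ N' ⟧t → ⟦ sub1 Γ N ⟧s ≈ ⟦ sub1 Γ N' ⟧s
  ⟦sub1⟧-cong Γ {Γ'} {σ} N N' N≈N' rewrite sub1≡ Γ N | sub1≡ Γ N' = proj-jointly-monic (Γ ++ σ ∷ Γ') _ _ pointwise
    where
    s = wkS {Γ} {Γ'}
    t = N ∷ ren (∈-++⁺ʳ Γ)
    t′ = N' ∷ ren (∈-++⁺ʳ Γ)
    ⟦lookup⟧ : ∀ {τ} (i : τ ∈ Γ ++ σ ∷ Γ') → ⟦ All.lookup (s ++ᴬ t) i ⟧t ≈ ⟦ All.lookup (s ++ᴬ t′) i ⟧t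
    ⟦lookup⟧ i with split Γ i
    ... | inl j = ≡⇒≈ (cong ⟦_⟧t (trans (lookup-++ᴬˡ s t j) (sym (lookup-++ᴬˡ s t′ j))))
    ... | inr (here refl) = ≈.trans (≡⇒≈ (cong ⟦_⟧t (lookup-++ᴬʳ s t (here refl))))
                              (≈.trans N≈N' (≡⇒≈ (cong ⟦_⟧t (sym (lookup-++ᴬʳ s t′ (here refl))))))
    ... | inr (there k) = ≡⇒≈ (cong ⟦_⟧t (trans (lookup-++ᴬʳ s t (there k)) (sym (lookup-++ᴬʳ s t′ (there k)))))
    pointwise : ∀ {τ} (i : τ ∈ Γ ++ σ ∷ Γ') → (proj i ∘ ⟦ s ++ᴬ t ⟧s) ≈ (proj i ∘ ⟦ s ++ᴬ t′ ⟧s)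
    pointwise i = ≈.trans (proj-∘-⟦⟧s (s ++ᴬ t) i) (≈.trans (⟦lookup⟧ i) (≈.sym (proj-∘-⟦⟧s (s ++ᴬ t′) i)))

  ⟦⟧fs-pointwise : ∀ {Γ n} (φs ψs : Vec (Fm Γ) n) → (∀ (i : Fin n) → ⟦ Vec.lookup φs i ⟧f ≈P ⟦ Vec.lookup ψs i ⟧f) →
                   Pointwise _≈P_ ⟦ φs ⟧fs ⟦ ψs ⟧fs
  ⟦⟧fs-pointwise [] [] h = []
  ⟦⟧fs-pointwise (φ ∷ φs) (ψ ∷ ψs) h = h fz ∷ ⟦⟧fs-pointwise φs ψs (λ i → h (fs i))

  module _ {T : Theory} (model : IsModel D S T) where

    sound : ∀ {a} → Der T a → Sat a
    ⟦sub1⟧-sound : ∀ {Δ σ M M'} Γ {Γ'} (ρ : InjRen Δ (Γ ++ Γ')) → Der T (eqn Δ σ M M') →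
                   ⟦ sub1 Γ (substTm (ren (proj₁ ρ)) M) ⟧s ≈ ⟦ sub1 Γ (substTm (ren (proj₁ ρ)) M') ⟧s

    ⟦sub1⟧-sound {M = M} {M'} Γ (ρ , _) d = ⟦sub1⟧-cong Γ _ _
      (≈.trans (⟦substTm⟧ (ren ρ) M) (≈.trans (∘-respˡ (sound d)) (≈.sym (⟦substTm⟧ (ren ρ) M'))))

    sound (hyp t) = model _ t
    sound (e-refl M) = ≈.refl
    sound (e-sym d) = ≈.sym (sound d)
    sound (e-trans d d′) = ≈.trans (sound d) (sound d′)
    sound (e-sub Γ Γ' {N} {N'} ρ d d′) =
      ≈.trans (⟦substTm⟧ _ N) (≈.trans (∘-resp (sound d′) (⟦sub1⟧-sound Γ ρ d)) (≈.sym (⟦substTm⟧ _ N')))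
    sound (ax φ) = ≤.refl
    sound (cut d d′) = ≤.trans (sound d) (sound d′)
    sound (cwk {Φ = Φ} {ψ} σ d) = ≤-respˡʳ-≈P (⟦substList⟧ _ Φ) (Pmap-mono _ (sound d)) (≤.Eq.sym (⟦substFm⟧ _ ψ))
    sound (sub Γ Γ' {Φ} {ψ} ρ d d′) =
      ≤-respˡʳ-≈P (⟦substList⟧ _ Φ) (≤.trans (Pmap-mono _ (sound d′)) (≤.reflexive (Pmap-resp (⟦sub1⟧-sound Γ ρ d) _)))
        (≤.Eq.sym (⟦substFm⟧ _ ψ))
    sound (Ω-con Ω d d′) = ≤.reflexive (quant-cong Ω _ _ (Pmap-cong _ (≤.antisym (sound d) (sound d′))))
    sound (◇-cong o φs ψs d d′) =
      ≤.reflexive (conn-cong o (⟦⟧fs-pointwise φs ψs (λ i → ≤.antisym (sound (d i)) (sound (d′ i)))))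
    sound (⊗-ref⇒ Φ α β Ψ θ d) = ≤.trans (≤.reflexive (⟦⟧hyps-cong-middle Φ {[ α ⊗F β ]} {α ∷ β ∷ []} Ψ ≤.Eq.refl)) (sound d)
    sound (⊗-ref⇐ Φ α β Ψ θ d) = ≤.trans (≤.reflexive (⟦⟧hyps-cong-middle Φ {α ∷ β ∷ []} {[ α ⊗F β ]} Ψ ≤.Eq.refl)) (sound d)
    sound (e-ref⇒ Φ Ψ φ d) = ≤.trans (≤.reflexive (⟦⟧hyps-cong-middle Φ {[]} {[ eF ]} Ψ ≤.Eq.refl)) (sound d)
    sound (e-ref⇐ Φ Ψ φ d) = ≤.trans (≤.reflexive (⟦⟧hyps-cong-middle Φ {[ eF ]} {[]} Ψ ≤.Eq.refl)) (sound d)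

module Completeness (L : Language) (Sg : Signature) (T : Syntax.Theory L Sg) where
  open Syntax L Sg
  open SubstitutionCalculus L Sg
  open DerivedRules L Sg T
  open ClassifyingLaws L Sg T
  open Semantics L Sg

  Subst→Tms : ∀ {Δ Γ} → Subst Δ Γ → Tms Δ Γ
  Subst→Tms [] = []
  Subst→Tms (M ∷ s) = M ∷ Subst→Tms s

  Tms→Subst : ∀ {Δ Γ} → Tms Δ Γ → Subst Δ Γ
  Tms→Subst [] = []
  Tms→Subst (M ∷ Ms) = M ∷ Tms→Subst Ms

  Subst→Tms∘Tms→Subst : ∀ {Δ Γ} (Ms : Tms Δ Γ) → Subst→Tms (Tms→Subst Ms) ≡ Ms
  Subst→Tms∘Tms→Subst [] = refl
  Subst→Tms∘Tms→Subst (M ∷ Ms) = cong (M ∷_) (Subst→Tms∘Tms→Subst Ms)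

  substTms-Subst→Tms : ∀ {Ε Δ Γ} (s : Subst Ε Δ) (t : Subst Δ Γ) → substTms s (Subst→Tms t) ≡ Subst→Tms (s ⊙ t)
  substTms-Subst→Tms s [] = refl
  substTms-Subst→Tms s (M ∷ t) = cong (_ ∷_) (substTms-Subst→Tms s t)

  ⟦_⟧ᶜ : Ctx → Ctx
  ⟦_⟧ᶜ = prodOf ClassData [_]

  ⟦⟧ᶜ≡ : ∀ Γ → ⟦ Γ ⟧ᶜ ≡ Γ
  ⟦⟧ᶜ≡ [] = refl
  ⟦⟧ᶜ≡ (σ ∷ []) = refl
  ⟦⟧ᶜ≡ (σ ∷ τ ∷ Γ) = cong (σ ∷_) (⟦⟧ᶜ≡ (τ ∷ Γ))

  ι : ∀ Γ → Subst ⟦ Γ ⟧ᶜ Γ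
  ι Γ = ren (∈-cast (sym (⟦⟧ᶜ≡ Γ)))

  κ : ∀ Γ → Subst Γ ⟦ Γ ⟧ᶜ
  κ Γ = ren (∈-cast (⟦⟧ᶜ≡ Γ))

  κ-⊙-ι : ∀ Γ → κ Γ ⊙ ι Γ ≡ idS
  κ-⊙-ι Γ = shift0-unique (shift-⊙ (shift-cast (⟦⟧ᶜ≡ Γ)) (shift-cast (sym (⟦⟧ᶜ≡ Γ)))) shift-idS

  -- Sorts are interpreted as one-variable contexts, so a product of sorts is
  -- the context itself (up to ⟦⟧ᶜ≡) and a morphism into a sort is a term.
  generic : Structure ClassData
  generic = record
    { sortI = [_]
    ; funI = λ {σs} f → app f (Subst→Tms (ι σs)) ∷ []
    ; relI = λ {σs} R → rel R (Subst→Tms (ι σs))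
    }

  open Interp ClassData generic

  proj-position : ∀ {Γ σ} (i : σ ∈ Γ) → Σ (σ ∈ ⟦ Γ ⟧ᶜ) λ j → (proj i ≡ var j ∷ []) × (position j ≡ position i)
  proj-position {σ ∷ []} (here refl) = here refl , refl , refl
  proj-position {σ ∷ τ ∷ Γ} (here refl) = here refl , refl , refl
  proj-position {σ ∷ τ ∷ Γ} (there i) with proj-position {τ ∷ Γ} i
  ... | j , proj≡j , pj = there j , trans (cong (All.map (substTm (ren (∈-++⁺ʳ [ σ ])))) proj≡j)
                                          (cong (_∷ []) (lookup-ren (∈-++⁺ʳ [ σ ]) j)) ,
                          cong suc pj

  proj≡ι : ∀ {Γ σ} (i : σ ∈ Γ) → proj i ≡ substTm (ι Γ) (var i) ∷ []
  proj≡ι {Γ} i with proj-position i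
  ... | j , proj≡j , pj = trans proj≡j (cong (_∷ [])
          (trans (cong var (position-injective _ _ (trans pj (sym (position-∈-cast (sym (⟦⟧ᶜ≡ Γ)) i)))))
                 (sym (lookup-ren (∈-cast (sym (⟦⟧ᶜ≡ Γ))) i))))

  ι-here : ∀ σ τ Γ → ∈-cast (sym (⟦⟧ᶜ≡ (σ ∷ τ ∷ Γ))) (here refl) ≡ here refl
  ι-here σ τ Γ = position-injective _ _ (position-∈-cast (sym (⟦⟧ᶜ≡ (σ ∷ τ ∷ Γ))) (here refl))

  ι-there : ∀ σ τ Γ {ρ} (i : ρ ∈ τ ∷ Γ) →
            ∈-cast (sym (⟦⟧ᶜ≡ (σ ∷ τ ∷ Γ))) (there i) ≡ there (∈-cast (sym (⟦⟧ᶜ≡ (τ ∷ Γ))) i)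
  ι-there σ τ Γ i = position-injective _ _
    (trans (position-∈-cast (sym (⟦⟧ᶜ≡ (σ ∷ τ ∷ Γ))) (there i)) (cong suc (sym (position-∈-cast (sym (⟦⟧ᶜ≡ (τ ∷ Γ))) i))))

  ⟦⟧ts-∷-⊙-ι : ∀ {Γ σ τ σs} (M : Tm Γ σ) (N : Tm Γ τ) (Ms : Tms Γ σs) → ⟦ M ⟧t ≡ substTm (ι Γ) M ∷ [] →
               ⟦ N ∷ Ms ⟧ts ⊙ ι (τ ∷ σs) ≡ Tms→Subst (substTms (ι Γ) (N ∷ Ms)) →
               ⟦ M ∷ N ∷ Ms ⟧ts ⊙ ι (σ ∷ τ ∷ σs) ≡ Tms→Subst (substTms (ι Γ) (M ∷ N ∷ Ms))
  ⟦⟧ts-∷-⊙-ι {Γ} {σ} {τ} {σs} M N Ms ⟦M⟧ ⟦N∷Ms⟧ = All-ext _ _ pointwise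
    where
    pointwise : ∀ {ρ} (i : ρ ∈ σ ∷ τ ∷ σs) →
                All.lookup (⟦ M ∷ N ∷ Ms ⟧ts ⊙ ι (σ ∷ τ ∷ σs)) i ≡ All.lookup (Tms→Subst (substTms (ι Γ) (M ∷ N ∷ Ms))) i
    pointwise (here refl) =
      trans (lookup-⊙-ren ⟦ M ∷ N ∷ Ms ⟧ts (∈-cast (sym (⟦⟧ᶜ≡ (σ ∷ τ ∷ σs)))) (here refl))
      (trans (cong (All.lookup (⟦ M ⟧t ++ᴬ ⟦ N ∷ Ms ⟧ts)) (ι-here σ τ σs))
      (trans (lookup-++ᴬˡ ⟦ M ⟧t ⟦ N ∷ Ms ⟧ts (here refl)) (cong (λ u → All.lookup u (here refl)) ⟦M⟧)))
    pointwise (there i) =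
      trans (lookup-⊙-ren ⟦ M ∷ N ∷ Ms ⟧ts (∈-cast (sym (⟦⟧ᶜ≡ (σ ∷ τ ∷ σs)))) (there i))
      (trans (cong (All.lookup (⟦ M ⟧t ++ᴬ ⟦ N ∷ Ms ⟧ts)) (ι-there σ τ σs i))
      (trans (lookup-++ᴬʳ ⟦ M ⟧t ⟦ N ∷ Ms ⟧ts _)
      (trans (sym (lookup-⊙-ren ⟦ N ∷ Ms ⟧ts (∈-cast (sym (⟦⟧ᶜ≡ (τ ∷ σs)))) i)) (cong (λ u → All.lookup u i) ⟦N∷Ms⟧))))

  mutual
    ⟦⟧t≡ι : ∀ {Γ σ} (M : Tm Γ σ) → ⟦ M ⟧t ≡ substTm (ι Γ) M ∷ []
    ⟦⟧t≡ι (var i) = proj≡ι i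
    ⟦⟧t≡ι {Γ} (app {σs} f Ms) = cong (λ u → app f u ∷ [])
      (trans (substTms-Subst→Tms ⟦ Ms ⟧ts (ι σs)) (trans (cong Subst→Tms (⟦⟧ts-⊙-ι Ms)) (Subst→Tms∘Tms→Subst _)))

    ⟦⟧ts-⊙-ι : ∀ {Γ σs} (Ms : Tms Γ σs) → ⟦ Ms ⟧ts ⊙ ι σs ≡ Tms→Subst (substTms (ι Γ) Ms)
    ⟦⟧ts-⊙-ι [] = refl
    ⟦⟧ts-⊙-ι (M ∷ []) rewrite ⟦⟧t≡ι M = refl
    ⟦⟧ts-⊙-ι (M ∷ N ∷ Ms) = ⟦⟧ts-∷-⊙-ι M N Ms (⟦⟧t≡ι M) (⟦⟧ts-⊙-ι (N ∷ Ms))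

  shift-ext : ∀ Γ σ → IsShift 0 (ext Γ σ)
  shift-ext [] σ = shift-∈-++⁺ʳ []
  shift-ext (τ ∷ []) σ = shift-idS
  shift-ext (τ ∷ ρ ∷ Γ) σ = shift-++ᴬ {Γ = [ τ ]}
    (shift-⊙ (shift-wkS {τ ∷ Q} {[ σ ]}) (shift-wkS {[ τ ]} {Q}))
    (shift-⊙ (shift-++ᴬ {Γ = Q} (shift-⊙ (shift-wkS {τ ∷ Q} {[ σ ]}) (shift-∈-++⁺ʳ [ τ ])) (shift-∈-++⁺ʳ (τ ∷ Q)))
             (shift-ext (ρ ∷ Γ) σ))
    where
    Q = ⟦ ρ ∷ Γ ⟧ᶜ

  ⟦qnt⟧≡ι : ∀ {Γ} Ω σ (φ : Fm (Γ ▹ σ)) → ⟦ φ ⟧f ≡ substFm (ι (Γ ▹ σ)) φ → ⟦ qnt Ω σ φ ⟧f ≡ substFm (ι Γ) (qnt Ω σ φ)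
  ⟦qnt⟧≡ι {Γ} Ω σ φ ⟦φ⟧ = cong (qnt Ω σ) (begin
    subst Fm p₁ (subst Fm p₂ (substFm (ext Γ σ) ⟦ φ ⟧f))
      ≡⟨ trans (subst-Fm≡ren p₁ _) (cong (substFm (ren (∈-cast p₁))) (subst-Fm≡ren p₂ _)) ⟩
    substFm (ren (∈-cast p₁)) (substFm (ren (∈-cast p₂)) (substFm (ext Γ σ) ⟦ φ ⟧f))
      ≡⟨ cong (λ x → substFm (ren (∈-cast p₁)) (substFm (ren (∈-cast p₂)) (substFm (ext Γ σ) x))) ⟦φ⟧ ⟩
    substFm (ren (∈-cast p₁)) (substFm (ren (∈-cast p₂)) (substFm (ext Γ σ) (substFm (ι (Γ ▹ σ)) φ)))
      ≡⟨ trans (cong (λ x → substFm (ren (∈-cast p₁)) (substFm (ren (∈-cast p₂)) x)) (substFm-⊙ _ _ φ))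
         (trans (cong (substFm (ren (∈-cast p₁))) (substFm-⊙ _ _ φ)) (substFm-⊙ _ _ φ)) ⟩
    substFm (ren (∈-cast p₁) ⊙ (ren (∈-cast p₂) ⊙ (ext Γ σ ⊙ ι (Γ ▹ σ)))) φ
      ≡⟨ substFm-shift (shift-⊙ (shift-cast p₁) (shift-⊙ (shift-cast p₂) (shift-⊙ (shift-ext Γ σ) (shift-cast _))))
                       (shift-lift σ (shift-cast _) (cong length (⟦⟧ᶜ≡ Γ))) φ ⟩
    substFm (lift (ι Γ) σ) φ ∎)
    where
    open ≡-Reasoning
    p₁ = ++-identityʳ (⟦ Γ ⟧ᶜ ▹ σ)
    p₂ = sym (++-assoc ⟦ Γ ⟧ᶜ [ σ ] [])

  mutual
    ⟦⟧f≡ι : ∀ {Γ} (φ : Fm Γ) → ⟦ φ ⟧f ≡ substFm (ι Γ) φ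
    ⟦⟧f≡ι (rel {σs = σs} R Ms) = cong (rel R)
      (trans (substTms-Subst→Tms ⟦ Ms ⟧ts (ι σs)) (trans (cong Subst→Tms (⟦⟧ts-⊙-ι Ms)) (Subst→Tms∘Tms→Subst _)))
    ⟦⟧f≡ι (eq σ M N) rewrite ⟦⟧t≡ι M | ⟦⟧t≡ι N = refl
    ⟦⟧f≡ι (con o φs) = cong (con o) (⟦⟧fs≡ι φs)
    ⟦⟧f≡ι (qnt Ω σ φ) = ⟦qnt⟧≡ι Ω σ φ (⟦⟧f≡ι φ)

    ⟦⟧fs≡ι : ∀ {Γ n} (φs : Vec (Fm Γ) n) → ⟦ φs ⟧fs ≡ substFms (ι Γ) φs
    ⟦⟧fs≡ι [] = refl
    ⟦⟧fs≡ι (φ ∷ φs) = cong₂ _∷_ (⟦⟧f≡ι φ) (⟦⟧fs≡ι φs)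

  tensor≡⨂ : ∀ {Γ} (Φ : List (Fm Γ)) → tensor (List.map ⟦_⟧f Φ) ≡ ⨂ (substList (ι Γ) Φ)
  tensor≡⨂ [] = refl
  tensor≡⨂ (φ ∷ []) = ⟦⟧f≡ι φ
  tensor≡⨂ (φ ∷ ψ ∷ Φ) = cong₂ _⊗F_ (⟦⟧f≡ι φ) (tensor≡⨂ (ψ ∷ Φ))

  Sat-eqn : ∀ {Γ τ} (M N : Tm Γ τ) → Sat (eqn Γ τ M N) ≡ (Der T (eqn ⟦ Γ ⟧ᶜ τ (substTm (ι Γ) M) (substTm (ι Γ) N)) × ⊤)
  Sat-eqn M N rewrite ⟦⟧t≡ι M | ⟦⟧t≡ι N = refl

  generic-isModel : IsModel ClassData generic T
  generic-isModel (eqn Γ τ M N) t = subst (λ X → X) (sym (Sat-eqn M N)) (subst-eqn (ι Γ) (ι Γ) (homEq-refl _) (hyp t) , tt)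
  generic-isModel (seq Γ Φ ψ) t = cast-seq (cong [_] (sym (tensor≡⨂ Φ))) (sym (⟦⟧f≡ι ψ))
    (tensor-intro₁ (substList (ι Γ) Φ) _ (subst-seq (ι Γ) (ι Γ) (homEq-refl _) (hyp t)))

  Sat⇒Der : ∀ a → Sat a → Der T a
  Sat⇒Der (eqn Γ τ M N) sat =
    cast-eqn (trans (substTm-⊙ (κ Γ) (ι Γ) M) (trans (cong (λ u → substTm u M) (κ-⊙-ι Γ)) (substTm-id M)))
             (trans (substTm-⊙ (κ Γ) (ι Γ) N) (trans (cong (λ u → substTm u N) (κ-⊙-ι Γ)) (substTm-id N)))
      (subst-eqn (κ Γ) (κ Γ) (homEq-refl _) (proj₁ (subst (λ X → X) (Sat-eqn M N) sat)))
  Sat⇒Der (seq Γ Φ ψ) sat =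
    cast-seq (trans (substList-⊙ (κ Γ) (ι Γ) Φ) (trans (cong (λ u → substList u Φ) (κ-⊙-ι Γ)) (substList-id Φ)))
             (trans (substFm-⊙ (κ Γ) (ι Γ) ψ) (trans (cong (λ u → substFm u ψ) (κ-⊙-ι Γ)) (substFm-id ψ)))
      (subst-seq (κ Γ) (κ Γ) (homEq-refl _) (tensor-elim₁ (substList (ι Γ) Φ) _ (cast-seq (cong [_] (tensor≡⨂ Φ)) (⟦⟧f≡ι ψ) sat)))

mainTheorem2 : (L : Language) {k : Level} (K : FA.FAObj L → Set k) →
    (∀ (Sg : Signature) (T : Syntax.Theory L Sg) → Syntax.IsLmTheory L Sg T →
      (laws : FA.FALaws L (Classifying.classData L Sg T)) →
      K (Classifying.classData L Sg T , laws)) →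
    (Sg : Signature) (T T' : Syntax.Theory L Sg) →
    (Syntax._⊢ₘ_ L Sg T T' → Semantics.Entails L Sg K T T') ×
    (Semantics.Entails L Sg K T T' → Syntax._⊢ₘ_ L Sg T T')
mainTheorem2 L K K-classifying Sg T T' = soundness , completeness
  where
  open Syntax L Sg using (Der; _⊢ₘ_)
  open Semantics L Sg using (Entails)
  open DerivedRules L Sg T using (Der-isLmTheory)
  open ClassifyingLaws L Sg T using (ClassData; classLaws)
  open Completeness L Sg T using (generic; generic-isModel; Sat⇒Der)

  soundness : T ⊢ₘ T' → Entails K T T'
  soundness T⊢T' (D , laws) _ S model a t = Soundness.sound L Sg D laws S model (T⊢T' a t)

  completeness : Entails K T T' → T ⊢ₘ T'
  completeness T⊨T' a t = Sat⇒Der a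
    (T⊨T' (ClassData , classLaws) (K-classifying Sg (Der T) Der-isLmTheory classLaws) generic generic-isModel a t)
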